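{- Let $n,k$ be natural numbers. Let $\mathcal A_n^{(k)}$ denote the set of max-ascending permutations of $\{0,1,\ldots,n+k+1\}$ (with parameters $n,k$). Then \[ |\mathcal A_n^{(k)}|=\sum_{m\ge 0} m!\,S(n+1,m+1)\; m!\,S(k+1,m+1)=\mathbb B_n^{(-k)}. \]
   Context: $S(a,b)$ denotes the Stirling number of the second kind, the number of partitions of an $a$-element set into $b$ nonempty classes. The poly-Bernoulli numbers are defined by $\sum_{n\ge0}\mathbb B_n^{(k)}\frac{x^n}{n!}=\frac{\mathrm{Li}_k(1-e^{ -x})}{1-e^{ -x}}$ with $\mathrm{Li}_k(x)=\sum_{i\ge1}x^i/i^k$, for $k\in\mathbb Z$. Consider sequences $\pi=(\pi(1),\pi(2),\ldots,\pi(n+k+2))$ that are permutations of $\{0,1,\ldots,n+k+1\}$ with $\pi(1)=0$ and $\pi(n+k+2)=n+k+1$. Positions $1,\ldots,n+1$ are called left positions and positions $n+2,\ldots,n+k+2$ are called right positions. Two left positions $i,j$ are equivalent if every integer $v$ strictly between $\pi(i)$ and $\pi(j)$ occupies a left position of $\pi$ (i.e. $\pi^{ -1}(v)\le n+1$); similarly two right positions $i,j$ are equivalent if every integer strictly between $\pi(i)$ and $\pi(j)$ occupies a right position. Such a $\pi$ is max-ascending if in every equivalence class (of left positions and of right positions) the values are increasing, i.e. for equivalent positions $i<j$ one has $\pi(i)<\pi(j)$. -}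

module Defs where

open import Data.Nat as ℕ using (ℕ; zero; suc; _+_; _*_; _∸_; _^_; _≤_; _!)
open import Data.Nat.Combinatorics using (_C_)
open import Data.Integer as ℤ using (ℤ; +_; -[1+_])
open import Data.Fin as Fin using (Fin; toℕ)
open import Data.Vec using (Vec; lookup)
open import Data.Sum using (_⊎_)
open import Data.Product using (_×_)
open import Relation.Binary.PropositionalEquality using (_≡_)

sumℕ : ℕ → (ℕ → ℕ) → ℕ
sumℕ zero    f = 0
sumℕ (suc b) f = sumℕ b f + f b

sumℤ : ℕ → (ℕ → ℤ) → ℤ
sumℤ zero    f = + 0
sumℤ (suc b) f = sumℤ b f ℤ.+ f b

S : ℕ → ℕ → ℕ
S zero    zero    = 1
S zero    (suc b) = 0
S (suc a) zero    = 0
S (suc a) (suc b) = suc b * S a (suc b) + S a b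

-- Σ_{m ≥ 0} m! S(n+1,m+1) m! S(k+1,m+1); all terms with m > n vanish,
-- we sum over m = 0 .. n+k (a safe finite range).
stirlingSum : ℕ → ℕ → ℕ
stirlingSum n k = sumℕ (suc (n + k)) λ m →
  (m ! * S (suc n) (suc m)) * (m ! * S (suc k) (suc m))

-- Exponential generating functions with integer coefficients:
-- a series Σ a_n x^n / n! is represented by  a : ℕ → ℤ.

EGF : Set
EGF = ℕ → ℤ

_⊛_ : EGF → EGF → EGF
(a ⊛ b) n = sumℤ (suc n) λ i → (+ (n C i)) ℤ.* (a i ℤ.* b (n ∸ i))

one : EGF
one zero    = + 1
one (suc _) = + 0

_^ᴱ_ : EGF → ℕ → EGF
a ^ᴱ zero  = one
a ^ᴱ suc j = a ⊛ (a ^ᴱ j)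

oneMinusExpNeg : EGF
oneMinusExpNeg zero          = + 0
oneMinusExpNeg (suc zero)    = + 1
oneMinusExpNeg (suc (suc n)) = ℤ.- oneMinusExpNeg (suc n)

-- Poly-Bernoulli numbers with non-positive index -k:
--   Σ_n B_n^{(-k)} x^n/n! = Li_{-k}(1-e^{-x}) / (1-e^{-x})
--                        = Σ_{i ≥ 1} i^k (1-e^{-x})^{i-1}.
-- Since (1-e^{-x})^{j} = O(x^j), only i-1 ≤ n contributes to the
-- coefficient of x^n/n!.
polyBernoulliNeg : ℕ → ℕ → ℤ
polyBernoulliNeg n k = sumℤ (suc n) λ j →
  (+ (suc j ^ k)) ℤ.* ((oneMinusExpNeg ^ᴱ j) n)

-- Max-ascending permutations.
-- A sequence π(1..N), N = n+k+2, is a vector of length N over Fin N;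
-- paper position p corresponds to the index p-1, paper value v to Fin v.

data Side : Set where
  left right : Side

OnSide : ∀ {N} → ℕ → Side → Fin N → Set
OnSide n left  p = toℕ p ≤ n
OnSide n right p = n ℕ.< toℕ p

StrictlyBetween : ∀ {N} → Fin N → Fin N → Fin N → Set
StrictlyBetween a v b = (a Fin.< v × v Fin.< b) ⊎ (b Fin.< v × v Fin.< a)

Equivalent : ∀ {N} → ℕ → Vec (Fin N) N → Side → Fin N → Fin N → Set
Equivalent {N} n π s i j =
  OnSide n s i × OnSide n s j ×
  ((v : Fin N) → StrictlyBetween (lookup π i) v (lookup π j) →
     (q : Fin N) → lookup π q ≡ v → OnSide n s q)

MaxAscending : ∀ {N} → ℕ → Vec (Fin N) N → Set
MaxAscending {N} n π = (s : Side) (i j : Fin N) → i Fin.< j →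
  Equivalent n π s i j → lookup π i Fin.< lookup π j

-- The set A_n^{(k)}.  Proof fields are irrelevant, so two elements are
-- equal iff their underlying sequences are equal.
record MaxAscPerm (n k : ℕ) : Set where
  field
    seq       : Vec (Fin (suc (suc (n + k)))) (suc (suc (n + k)))
    .isPerm   : (i j : Fin (suc (suc (n + k)))) → lookup seq i ≡ lookup seq j → i ≡ j
    .firstVal : lookup seq Fin.zero ≡ Fin.zero
    .lastVal  : lookup seq (Fin.fromℕ (suc (n + k))) ≡ Fin.fromℕ (suc (n + k))
    .maxAsc   : MaxAscending n seq

module Submission where

-- Write ordS n m = m! S(n+1,m+1).  The proof has two independent halves.
--
-- With ω = 1 - e^{-x} the paper's generating
-- function is Σ_j (j+1)^k ω^j.  Expanding (j+1)^k = Σ_m ordS k m C(j,m) and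
-- exchanging sums leaves Σ_j C(j,m) [xⁿ/n!] ω^j, which equals ordS n m: both
-- satisfy the recurrence ordS (n+1) m = (m+1) ordS n m + m ordS n (m-1), the
-- left side by the differential equation (ω^{j+1})' = (j+1)(ω^j - ω^{j+1}).
--
-- Bijection.  ordS n m counts surjections {0..n} → {0..m} sending n to 0
-- (split off the first value).  The values of a max-ascending permutation
-- form runs lying alternately on the left and right sides; pairing each left
-- run with the following right run gives blocks 0..m, each meeting both
-- sides, with value 0 in block 0 and value T = n+k+1 in block m.
-- Recording the block of every left and every right position gives two such
-- surjections, and conversely ranking positions by (block, side, position)
-- rebuilds the permutation.

open import Defs
open import Data.Nat using (ℕ)
open import Data.Fin using (Fin)
open import Data.Integer using (+_)
open import Data.Product using (_×_)
open import Function.Bundles using (_↔_)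
open import Relation.Binary.PropositionalEquality using (_≡_)

open import Data.Nat as ℕ using (zero; suc; pred; _+_; _*_; _∸_; _^_; _!; _≤_; _<_; z≤n; s≤s; _≤?_; _<?_)
import Data.Nat.Properties as ℕP
open import Data.Nat.Combinatorics using (_C_; nCk+nC[k+1]≡[n+1]C[k+1])
open import Data.Integer using (ℤ)
  renaming (_+_ to _+ᶻ_; _*_ to _*ᶻ_; -_ to -ᶻ_; _-_ to _-ᶻ_)
import Data.Integer.Properties as ℤP
open import Data.Bool using (Bool; true; false; _∧_; not)
import Data.Bool.Properties as BP
open import Data.Fin as F using (toℕ; fromℕ<)
import Data.Fin.Properties as FP
open import Data.Vec as V using (Vec; []; _∷_)
import Data.Vec.Properties as VP
open import Data.Product using (∃; _,_; proj₁; proj₂)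
open import Data.Sum using (_⊎_; inj₁; inj₂)
open import Data.Empty using (⊥; ⊥-elim)
import Data.Empty.Irrelevant as Irrelevant
open import Relation.Nullary using (Dec; yes; no; ¬_)
open import Relation.Nullary.Decidable using (isYes; recompute)
open import Relation.Binary.PropositionalEquality
  using (refl; sym; trans; cong; cong₂; subst; subst₂; _≢_; module ≡-Reasoning)
open import Relation.Binary.Definitions using (tri<; tri≈; tri>)
open import Function.Bundles using (mk↔ₛ′)
open import Function.Construct.Composition using (_↔-∘_)
open import Function.Construct.Symmetry using (↔-sym)
open import Function.Construct.Identity using (↔-id)
open import Data.Sum.Function.Propositional using (_⊎-↔_)
open import Data.Product.Function.NonDependent.Propositional using (_×-↔_)
open import Algebra.Properties.CommutativeSemigroup ℤP.+-commutativeSemigroup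
  using () renaming (interchange to +ᶻ-interchange; x∙yz≈y∙xz to +ᶻ-left-comm)
open import Algebra.Properties.CommutativeSemigroup ℕP.+-commutativeSemigroup
  using () renaming (interchange to +-interchange)
import Data.Integer.Tactic.RingSolver as ℤ-Solver
import Data.Nat.Tactic.RingSolver as ℕ-Solver

open ≡-Reasoning

sumℤ-cong : ∀ b {f g : ℕ → ℤ} → (∀ i → i < b → f i ≡ g i) → sumℤ b f ≡ sumℤ b g
sumℤ-cong zero    h = refl
sumℤ-cong (suc b) h =
  cong₂ _+ᶻ_ (sumℤ-cong b (λ i i<b → h i (ℕP.m<n⇒m<1+n i<b))) (h b (ℕP.n<1+n b))

sumℤ-+ : ∀ b (f g : ℕ → ℤ) → sumℤ b (λ i → f i +ᶻ g i) ≡ sumℤ b f +ᶻ sumℤ b g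
sumℤ-+ zero    f g = refl
sumℤ-+ (suc b) f g = trans (cong (_+ᶻ (f b +ᶻ g b)) (sumℤ-+ b f g))
                           (+ᶻ-interchange (sumℤ b f) (sumℤ b g) (f b) (g b))

sumℤ-*ˡ : ∀ b (c : ℤ) (f : ℕ → ℤ) → sumℤ b (λ i → c *ᶻ f i) ≡ c *ᶻ sumℤ b f
sumℤ-*ˡ zero    c f = sym (ℤP.*-zeroʳ c)
sumℤ-*ˡ (suc b) c f = trans (cong (_+ᶻ (c *ᶻ f b)) (sumℤ-*ˡ b c f))
                            (sym (ℤP.*-distribˡ-+ c (sumℤ b f) (f b)))

sumℤ-*ʳ : ∀ b (f : ℕ → ℤ) (c : ℤ) → sumℤ b (λ i → f i *ᶻ c) ≡ sumℤ b f *ᶻ c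
sumℤ-*ʳ b f c = trans (sumℤ-cong b (λ i _ → ℤP.*-comm (f i) c))
                      (trans (sumℤ-*ˡ b c f) (ℤP.*-comm c (sumℤ b f)))

sumℤ-neg : ∀ b (f : ℕ → ℤ) → sumℤ b (λ i → -ᶻ f i) ≡ -ᶻ sumℤ b f
sumℤ-neg zero    f = refl
sumℤ-neg (suc b) f = trans (cong (_+ᶻ (-ᶻ f b)) (sumℤ-neg b f))
                           (sym (ℤP.neg-distrib-+ (sumℤ b f) (f b)))

sumℤ-- : ∀ b (f g : ℕ → ℤ) → sumℤ b (λ i → f i -ᶻ g i) ≡ sumℤ b f -ᶻ sumℤ b g
sumℤ-- b f g = trans (sumℤ-+ b f (λ i → -ᶻ g i)) (cong (sumℤ b f +ᶻ_) (sumℤ-neg b g))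

sumℤ-shift : ∀ b (f : ℕ → ℤ) → sumℤ (suc b) f ≡ f 0 +ᶻ sumℤ b (λ i → f (suc i))
sumℤ-shift zero    f = trans (ℤP.+-identityˡ (f 0)) (sym (ℤP.+-identityʳ (f 0)))
sumℤ-shift (suc b) f = trans (cong (_+ᶻ f (suc b)) (sumℤ-shift b f))
                             (ℤP.+-assoc (f 0) (sumℤ b (λ i → f (suc i))) (f (suc b)))

sumℤ-zero : ∀ b (f : ℕ → ℤ) → (∀ i → i < b → f i ≡ + 0) → sumℤ b f ≡ + 0
sumℤ-zero zero    f h = refl
sumℤ-zero (suc b) f h =
  cong₂ _+ᶻ_ (sumℤ-zero b f (λ i i<b → h i (ℕP.m<n⇒m<1+n i<b))) (h b (ℕP.n<1+n b))

sumℤ-dropLast : ∀ b (f : ℕ → ℤ) → f b ≡ + 0 → sumℤ (suc b) f ≡ sumℤ b f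
sumℤ-dropLast b f h = trans (cong (sumℤ b f +ᶻ_) h) (ℤP.+-identityʳ _)

sumℤ-swap : ∀ a b (f : ℕ → ℕ → ℤ) →
  sumℤ a (λ i → sumℤ b (λ j → f i j)) ≡ sumℤ b (λ j → sumℤ a (λ i → f i j))
sumℤ-swap zero    b f = sym (sumℤ-zero b _ (λ _ _ → refl))
sumℤ-swap (suc a) b f = trans (cong (_+ᶻ sumℤ b (f a)) (sumℤ-swap a b f))
                              (sym (sumℤ-+ b (λ j → sumℤ a (λ i → f i j)) (f a)))

sumℤ-rotate : ∀ b (f : ℕ → ℤ) → f 0 ≡ + 0 → f b ≡ + 0 → sumℤ b (λ j → f (suc j)) ≡ sumℤ b f
sumℤ-rotate b f f0≡0 fb≡0 = begin
  sumℤ b (λ j → f (suc j))        ≡⟨ sym (ℤP.+-identityˡ _) ⟩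
  + 0 +ᶻ sumℤ b (λ j → f (suc j)) ≡⟨ cong (_+ᶻ sumℤ b (λ j → f (suc j))) (sym f0≡0) ⟩
  f 0 +ᶻ sumℤ b (λ j → f (suc j)) ≡⟨ sym (sumℤ-shift b f) ⟩
  sumℤ (suc b) f                  ≡⟨ sumℤ-dropLast b f fb≡0 ⟩
  sumℤ b f                        ∎

pos-sumℕ : ∀ b (f : ℕ → ℕ) → + sumℕ b f ≡ sumℤ b (λ i → + f i)
pos-sumℕ zero    f = refl
pos-sumℕ (suc b) f = trans (ℤP.pos-+ (sumℕ b f) (f b)) (cong (_+ᶻ + f b) (pos-sumℕ b f))

-- Binomial coefficients via Pascal's rule; this structurally recursive form
-- is what the inductions below need, and it agrees with the library's _C_.

binom : ℕ → ℕ → ℕ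
binom n       zero    = 1
binom zero    (suc k) = 0
binom (suc n) (suc k) = binom n k + binom n (suc k)

binom≡C : ∀ n k → binom n k ≡ n C k
binom≡C n       zero    = refl
binom≡C zero    (suc k) = refl
binom≡C (suc n) (suc k) = trans (cong₂ _+_ (binom≡C n k) (binom≡C n (suc k)))
                                (nCk+nC[k+1]≡[n+1]C[k+1] n k)

binom-vanish : ∀ n k → n < k → binom n k ≡ 0
binom-vanish zero    (suc k) _         = refl
binom-vanish (suc n) (suc k) (s≤s n<k) =
  cong₂ _+_ (binom-vanish n k n<k) (binom-vanish n (suc k) (ℕP.m<n⇒m<1+n n<k))

binom-absorb : ∀ j m → suc m * binom (suc j) (suc m) ≡ suc j * binom j m
binom-absorb zero    zero    = refl
binom-absorb zero    (suc m) = ℕP.*-zeroʳ (suc (suc m))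
binom-absorb (suc j) zero    = begin
  1 * (1 + binom (suc j) 1)     ≡⟨ cong (λ z → 1 * (1 + z)) (sym (ℕP.*-identityˡ _)) ⟩
  1 * (1 + 1 * binom (suc j) 1) ≡⟨ cong (λ z → 1 * (1 + z)) (binom-absorb j 0) ⟩
  1 * (1 + suc j * 1)           ≡⟨ simplify j ⟩
  suc (suc j) * 1               ∎
  where
  simplify : ∀ j → 1 * (1 + suc j * 1) ≡ suc (suc j) * 1
  simplify = ℕ-Solver.solve-∀
binom-absorb (suc j) (suc m) = begin
  suc (suc m) * (B (suc m) + B (suc (suc m)))
    ≡⟨ expand m (B (suc m)) (B (suc (suc m))) ⟩
  (suc m * B (suc m) + B (suc m)) + suc (suc m) * B (suc (suc m))
    ≡⟨ cong₂ (λ x y → (x + B (suc m)) + y) (binom-absorb j m) (binom-absorb j (suc m)) ⟩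
  (suc j * binom j m + B (suc m)) + suc j * binom j (suc m)
    ≡⟨ collect (suc j) (binom j m) (binom j (suc m)) ⟩
  suc (suc j) * (binom j m + binom j (suc m)) ∎
  where
  B : ℕ → ℕ
  B = binom (suc j)
  expand : ∀ m x y → suc (suc m) * (x + y) ≡ (suc m * x + x) + suc (suc m) * y
  expand = ℕ-Solver.solve-∀
  collect : ∀ a x y → (a * x + (x + y)) + a * y ≡ suc a * (x + y)
  collect = ℕ-Solver.solve-∀

-- Calculus of exponential generating functions.  The derivative ∂ shifts
-- coefficients; the product ⊛ obeys the Leibniz rule.

∂ : EGF → EGF
∂ a i = a (suc i)

⊛-binom : ∀ a b n → (a ⊛ b) n ≡ sumℤ (suc n) (λ i → + binom n i *ᶻ (a i *ᶻ b (n ∸ i)))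
⊛-binom a b n = sumℤ-cong (suc n) (λ i _ → cong (λ z → + z *ᶻ (a i *ᶻ b (n ∸ i))) (sym (binom≡C n i)))

-- Leibniz rule  (a ⊛ b)' = a' ⊛ b + a ⊛ b'  on the coefficient of xⁿ/n!:
-- split each binomial by Pascal's rule and reindex one of the two sums.
leibniz : ∀ a b n → (a ⊛ b) (suc n) ≡ (∂ a ⊛ b) n +ᶻ (a ⊛ ∂ b) n
leibniz a b n = begin
  (a ⊛ b) (suc n)                                    ≡⟨ ⊛-binom a b (suc n) ⟩
  sumℤ (suc (suc n)) T                               ≡⟨ sumℤ-shift (suc n) T ⟩
  T 0 +ᶻ sumℤ (suc n) (λ i → T (suc i))              ≡⟨ cong (T 0 +ᶻ_) (sumℤ-cong (suc n) (λ i _ → pascal i)) ⟩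
  T 0 +ᶻ sumℤ (suc n) (λ i → U i +ᶻ V i)             ≡⟨ cong (T 0 +ᶻ_) (sumℤ-+ (suc n) U V) ⟩
  T 0 +ᶻ (sumℤ (suc n) U +ᶻ sumℤ (suc n) V)          ≡⟨ +ᶻ-left-comm (T 0) (sumℤ (suc n) U) (sumℤ (suc n) V) ⟩
  sumℤ (suc n) U +ᶻ (T 0 +ᶻ sumℤ (suc n) V)          ≡⟨ cong (λ z → sumℤ (suc n) U +ᶻ (T 0 +ᶻ z)) reindex ⟩
  sumℤ (suc n) U +ᶻ (W 0 +ᶻ sumℤ n (λ i → W (suc i))) ≡⟨ cong (sumℤ (suc n) U +ᶻ_) (sym (sumℤ-shift n W)) ⟩
  sumℤ (suc n) U +ᶻ sumℤ (suc n) W                   ≡⟨ sym (cong₂ _+ᶻ_ (⊛-binom (∂ a) b n) (⊛-binom a (∂ b) n)) ⟩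
  (∂ a ⊛ b) n +ᶻ (a ⊛ ∂ b) n                         ∎
  where
  T U V W : ℕ → ℤ
  T i = + binom (suc n) i *ᶻ (a i *ᶻ b (suc n ∸ i))
  U i = + binom n i *ᶻ (a (suc i) *ᶻ b (n ∸ i))
  V i = + binom n (suc i) *ᶻ (a (suc i) *ᶻ b (n ∸ i))
  W i = + binom n i *ᶻ (a i *ᶻ b (suc (n ∸ i)))
  pascal : ∀ i → T (suc i) ≡ U i +ᶻ V i
  pascal i = trans (cong (_*ᶻ (a (suc i) *ᶻ b (n ∸ i))) (ℤP.pos-+ (binom n i) (binom n (suc i))))
                   (ℤP.*-distribʳ-+ (a (suc i) *ᶻ b (n ∸ i)) (+ binom n i) (+ binom n (suc i)))
  lastV≡0 : V n ≡ + 0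
  lastV≡0 = trans (cong (λ z → + z *ᶻ (a (suc n) *ᶻ b (n ∸ n))) (binom-vanish n (suc n) (ℕP.n<1+n n)))
                  (ℤP.*-zeroˡ (a (suc n) *ᶻ b (n ∸ n)))
  reindex : sumℤ (suc n) V ≡ sumℤ n (λ i → W (suc i))
  reindex = trans (sumℤ-dropLast n V lastV≡0)
    (sumℤ-cong n (λ i i<n → cong (λ z → + binom n (suc i) *ᶻ (a (suc i) *ᶻ b z)) (ℕP.+-∸-assoc 1 i<n)))

⊛-congʳ : ∀ a (b c : EGF) n → (∀ i → b i ≡ c i) → (a ⊛ b) n ≡ (a ⊛ c) n
⊛-congʳ a b c n h = sumℤ-cong (suc n) (λ i _ → cong (λ z → + (n C i) *ᶻ (a i *ᶻ z)) (h (n ∸ i)))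

⊛-congˡ : ∀ (a c : EGF) b n → (∀ i → a i ≡ c i) → (a ⊛ b) n ≡ (c ⊛ b) n
⊛-congˡ a c b n h = sumℤ-cong (suc n) (λ i _ → cong (λ z → + (n C i) *ᶻ (z *ᶻ b (n ∸ i))) (h i))

⊛-distribʳ-- : ∀ (x y b : EGF) n → ((λ i → x i -ᶻ y i) ⊛ b) n ≡ (x ⊛ b) n -ᶻ (y ⊛ b) n
⊛-distribʳ-- x y b n =
  trans (sumℤ-cong (suc n) (λ i _ → distrib (+ (n C i)) (x i) (y i) (b (n ∸ i)))) (sumℤ-- (suc n) _ _)
  where
  distrib : ∀ (c x y z : ℤ) → c *ᶻ ((x -ᶻ y) *ᶻ z) ≡ c *ᶻ (x *ᶻ z) -ᶻ c *ᶻ (y *ᶻ z)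
  distrib = ℤ-Solver.solve-∀

⊛-scaled-difference : ∀ (a x y : EGF) (d : ℤ) n →
  (a ⊛ (λ i → d *ᶻ (x i -ᶻ y i))) n ≡ d *ᶻ ((a ⊛ x) n -ᶻ (a ⊛ y) n)
⊛-scaled-difference a x y d n =
  trans (sumℤ-cong (suc n) (λ i _ → distrib (+ (n C i)) d (x (n ∸ i)) (y (n ∸ i)) (a i)))
        (trans (sumℤ-*ˡ (suc n) d _) (cong (d *ᶻ_) (sumℤ-- (suc n) _ _)))
  where
  distrib : ∀ (c d x y z : ℤ) → c *ᶻ (z *ᶻ (d *ᶻ (x -ᶻ y))) ≡ d *ᶻ (c *ᶻ (z *ᶻ x) -ᶻ c *ᶻ (z *ᶻ y))
  distrib = ℤ-Solver.solve-∀

⊛-zeroʳ : ∀ (a : EGF) n → (a ⊛ (λ _ → + 0)) n ≡ + 0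
⊛-zeroʳ a n = sumℤ-zero (suc n) _
  (λ i _ → trans (cong (+ (n C i) *ᶻ_) (ℤP.*-zeroʳ (a i))) (ℤP.*-zeroʳ (+ (n C i))))

⊛-identityˡ : ∀ (x : EGF) n → (one ⊛ x) n ≡ x n
⊛-identityˡ x n = trans (sumℤ-shift n _) (trans (cong₂ _+ᶻ_ first rest≡0) (ℤP.+-identityʳ (x n)))
  where
  first : + (n C 0) *ᶻ (+ 1 *ᶻ x (n ∸ 0)) ≡ x n
  first = trans (ℤP.*-identityˡ (+ 1 *ᶻ x n)) (ℤP.*-identityˡ (x n))
  rest≡0 : sumℤ n (λ i → + (n C suc i) *ᶻ (+ 0 *ᶻ x (n ∸ suc i))) ≡ + 0
  rest≡0 = sumℤ-zero n _ (λ i _ → trans (cong (+ (n C suc i) *ᶻ_) (ℤP.*-zeroˡ (x (n ∸ suc i))))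
                                        (ℤP.*-zeroʳ (+ (n C suc i))))

ω : EGF
ω = oneMinusExpNeg

ω^ : ℕ → EGF
ω^ j = ω ^ᴱ j

∂ω : ∀ i → ∂ ω i ≡ one i -ᶻ ω i
∂ω zero    = refl
∂ω (suc i) = sym (ℤP.+-identityˡ (-ᶻ ω (suc i)))

∂ω^ : ∀ j n → ω^ (suc j) (suc n) ≡ + suc j *ᶻ (ω^ j n -ᶻ ω^ (suc j) n)
∂ω^ j n = begin
  ω^ (suc j) (suc n)                                   ≡⟨ leibniz ω (ω^ j) n ⟩
  (∂ ω ⊛ ω^ j) n +ᶻ (ω ⊛ ∂ (ω^ j)) n                   ≡⟨ cong (_+ᶻ (ω ⊛ ∂ (ω^ j)) n) ∂ω⊛ω^ ⟩
  (ω^ j n -ᶻ ω^ (suc j) n) +ᶻ (ω ⊛ ∂ (ω^ j)) n         ≡⟨ add-ω⊛∂ω^ j ⟩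
  + suc j *ᶻ (ω^ j n -ᶻ ω^ (suc j) n)                  ∎
  where
  ∂ω⊛ω^ : (∂ ω ⊛ ω^ j) n ≡ ω^ j n -ᶻ ω^ (suc j) n
  ∂ω⊛ω^ = trans (⊛-congˡ (∂ ω) (λ i → one i -ᶻ ω i) (ω^ j) n ∂ω)
                (trans (⊛-distribʳ-- one ω (ω^ j) n) (cong (_-ᶻ ω^ (suc j) n) (⊛-identityˡ (ω^ j) n)))
  -- ω ⊛ (ω^j)' = j (ω^j - ω^{j+1}), by the differential equation for ω^j.
  add-ω⊛∂ω^ : ∀ j → (ω^ j n -ᶻ ω^ (suc j) n) +ᶻ (ω ⊛ ∂ (ω^ j)) n ≡ + suc j *ᶻ (ω^ j n -ᶻ ω^ (suc j) n)
  add-ω⊛∂ω^ zero = trans (cong ((ω^ 0 n -ᶻ ω^ 1 n) +ᶻ_) (⊛-zeroʳ ω n)) (plus0 _)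
    where
    plus0 : ∀ (X : ℤ) → X +ᶻ + 0 ≡ + 1 *ᶻ X
    plus0 = ℤ-Solver.solve-∀
  add-ω⊛∂ω^ (suc j) = trans
    (cong ((ω^ (suc j) n -ᶻ ω^ (suc (suc j)) n) +ᶻ_) (trans (⊛-congʳ ω (∂ (ω^ (suc j))) (λ i → + suc j *ᶻ (ω^ j i -ᶻ ω^ (suc j) i)) n (∂ω^ j))
                         (⊛-scaled-difference ω (ω^ j) (ω^ (suc j)) (+ suc j) n)))
    (collect _ (+ suc j))
    where
    collect : ∀ (X c : ℤ) → X +ᶻ c *ᶻ X ≡ (+ 1 +ᶻ c) *ᶻ X
    collect = ℤ-Solver.solve-∀

ω^-vanish : ∀ j n → n < j → ω^ j n ≡ + 0
ω^-vanish (suc j) zero    _         =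
  trans (ℤP.+-identityˡ _) (trans (ℤP.*-identityˡ _) (ℤP.*-zeroˡ (ω^ j 0)))
ω^-vanish (suc j) (suc n) (s≤s n<j) = trans (∂ω^ j n)
  (trans (cong₂ (λ x y → + suc j *ᶻ (x -ᶻ y)) (ω^-vanish j n n<j) (ω^-vanish (suc j) n (ℕP.m<n⇒m<1+n n<j)))
         (ℤP.*-zeroʳ (+ suc j)))

ordS : ℕ → ℕ → ℕ
ordS n m = m ! * S (suc n) (suc m)

ordS-rec : ∀ n m → ordS (suc n) m ≡ suc m * ordS n m + m * ordS n (pred m)
ordS-rec n zero    = base (S (suc n) 1)
  where
  base : ∀ X → 1 * (1 * X + 0) ≡ 1 * (1 * X) + 0 * (1 * X)
  base = ℕ-Solver.solve-∀
ordS-rec n (suc m) = step m (m !) (S (suc n) (suc m)) (S (suc n) (suc (suc m)))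
  where
  step : ∀ m f X Y → (suc m * f) * (suc (suc m) * Y + X) ≡ suc (suc m) * ((suc m * f) * Y) + suc m * (f * X)
  step = ℕ-Solver.solve-∀

S-vanish : ∀ x y → x < y → S x y ≡ 0
S-vanish zero    (suc y) _         = refl
S-vanish (suc x) (suc y) (s≤s x<y) =
  cong₂ _+_ (trans (cong (suc y *_) (S-vanish x (suc y) (ℕP.m<n⇒m<1+n x<y))) (ℕP.*-zeroʳ (suc y)))
            (S-vanish x y x<y)

ordS-vanish : ∀ k m → k < m → ordS k m ≡ 0
ordS-vanish k m k<m = trans (cong (m ! *_) (S-vanish (suc k) (suc m) (s≤s k<m))) (ℕP.*-zeroʳ (m !))

-- Coefficient extraction:  Σ_{j ≤ n} C(j,m) [xⁿ/n!] ω^j = m! S(n+1,m+1).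
-- Both sides satisfy the recurrence of ordS; for the left side this follows
-- from the differential equation for ω^j and the Pascal-type identity
-- C(j+1,m)(j+1) = C(j,m) j + (m+1) C(j,m) + m C(j,m-1).

binomω^Sum : ℕ → ℕ → ℤ
binomω^Sum m n = sumℤ (suc n) (λ j → + binom j m *ᶻ ω^ j n)

binom-step : ∀ j m → binom (suc j) m * suc j ≡ binom j m * j + (suc m * binom j m + m * binom j (pred m))
binom-step j zero    = rearrange j
  where
  rearrange : ∀ j → 1 * suc j ≡ 1 * j + (1 * 1 + 0 * 1)
  rearrange = ℕ-Solver.solve-∀
binom-step j (suc m) = begin
  (binom j m + binom j (suc m)) * suc j
    ≡⟨ distrib (binom j m) (binom j (suc m)) j ⟩
  suc j * binom j m + suc j * binom j (suc m)
    ≡⟨ cong (_+ suc j * binom j (suc m)) (sym (binom-absorb j m)) ⟩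
  suc m * binom (suc j) (suc m) + suc j * binom j (suc m)
    ≡⟨ rearrange m (binom j m) (binom j (suc m)) j ⟩
  binom j (suc m) * j + (suc (suc m) * binom j (suc m) + suc m * binom j m) ∎
  where
  distrib : ∀ x y j → (x + y) * suc j ≡ suc j * x + suc j * y
  distrib = ℕ-Solver.solve-∀
  rearrange : ∀ m x y j → suc m * (x + y) + suc j * y ≡ y * j + (suc (suc m) * y + suc m * x)
  rearrange = ℕ-Solver.solve-∀

binom-step-ℤ : ∀ j m (w : ℤ) →
  + (binom (suc j) m * suc j) *ᶻ w -ᶻ + (binom j m * j) *ᶻ w
    ≡ + suc m *ᶻ (+ binom j m *ᶻ w) +ᶻ + m *ᶻ (+ binom j (pred m) *ᶻ w)
binom-step-ℤ j m w = begin
  + (binom (suc j) m * suc j) *ᶻ w -ᶻ + (c * j) *ᶻ w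
    ≡⟨ cong (λ z → + z *ᶻ w -ᶻ + (c * j) *ᶻ w) (binom-step j m) ⟩
  + (c * j + (suc m * c + m * d)) *ᶻ w -ᶻ + (c * j) *ᶻ w
    ≡⟨ cong (λ z → z *ᶻ w -ᶻ + (c * j) *ᶻ w) (trans (ℤP.pos-+ (c * j) (suc m * c + m * d))
         (cong (+ (c * j) +ᶻ_) (trans (ℤP.pos-+ (suc m * c) (m * d))
           (cong₂ _+ᶻ_ (ℤP.pos-* (suc m) c) (ℤP.pos-* m d))))) ⟩
  (+ (c * j) +ᶻ (+ suc m *ᶻ + c +ᶻ + m *ᶻ + d)) *ᶻ w -ᶻ + (c * j) *ᶻ w
    ≡⟨ cancel (+ (c * j)) (+ suc m) (+ c) (+ m) (+ d) w ⟩
  + suc m *ᶻ (+ c *ᶻ w) +ᶻ + m *ᶻ (+ d *ᶻ w) ∎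
  where
  c d : ℕ
  c = binom j m
  d = binom j (pred m)
  cancel : ∀ (A s b t c p : ℤ) → (A +ᶻ (s *ᶻ b +ᶻ t *ᶻ c)) *ᶻ p -ᶻ A *ᶻ p ≡ s *ᶻ (b *ᶻ p) +ᶻ t *ᶻ (c *ᶻ p)
  cancel = ℤ-Solver.solve-∀

scaled-∂ω^ : ∀ (c : ℤ) j n → c *ᶻ ω^ (suc j) (suc n) ≡ (c *ᶻ + suc j) *ᶻ ω^ j n -ᶻ (c *ᶻ + suc j) *ᶻ ω^ (suc j) n
scaled-∂ω^ c j n = trans (cong (c *ᶻ_) (∂ω^ j n)) (distrib c (+ suc j) (ω^ j n) (ω^ (suc j) n))
  where
  distrib : ∀ (c d x y : ℤ) → c *ᶻ (d *ᶻ (x -ᶻ y)) ≡ (c *ᶻ d) *ᶻ x -ᶻ (c *ᶻ d) *ᶻ y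
  distrib = ℤ-Solver.solve-∀

-- Differentiating term by term turns the sum for n+1 into a difference of two
-- sums for n, one of them shifted; the shift is harmless since its boundary
-- terms vanish (j = 0, and ω^{n+1} = O(x^{n+1})).
binomω^Sum-rec : ∀ m n → binomω^Sum m (suc n) ≡ + suc m *ᶻ binomω^Sum m n +ᶻ + m *ᶻ binomω^Sum (pred m) n
binomω^Sum-rec m n = begin
  binomω^Sum m (suc n)
    ≡⟨ sumℤ-shift (suc n) F ⟩
  F 0 +ᶻ sumℤ (suc n) (λ j → F (suc j))
    ≡⟨ cong₂ _+ᶻ_ (ℤP.*-zeroʳ (+ binom 0 m)) (sumℤ-cong (suc n) (λ j _ → F-suc j)) ⟩
  + 0 +ᶻ sumℤ (suc n) (λ j → G j -ᶻ H (suc j))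
    ≡⟨ ℤP.+-identityˡ _ ⟩
  sumℤ (suc n) (λ j → G j -ᶻ H (suc j))
    ≡⟨ sumℤ-- (suc n) G (λ j → H (suc j)) ⟩
  sumℤ (suc n) G -ᶻ sumℤ (suc n) (λ j → H (suc j))
    ≡⟨ cong (λ z → sumℤ (suc n) G -ᶻ z) (sumℤ-rotate (suc n) H H0≡0 Hlast≡0) ⟩
  sumℤ (suc n) G -ᶻ sumℤ (suc n) H
    ≡⟨ sym (sumℤ-- (suc n) G H) ⟩
  sumℤ (suc n) (λ j → G j -ᶻ H j)
    ≡⟨ sumℤ-cong (suc n) (λ j _ → binom-step-ℤ j m (ω^ j n)) ⟩
  sumℤ (suc n) (λ j → + suc m *ᶻ X j +ᶻ + m *ᶻ Y j)
    ≡⟨ sumℤ-+ (suc n) _ _ ⟩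
  sumℤ (suc n) (λ j → + suc m *ᶻ X j) +ᶻ sumℤ (suc n) (λ j → + m *ᶻ Y j)
    ≡⟨ cong₂ _+ᶻ_ (sumℤ-*ˡ (suc n) (+ suc m) X) (sumℤ-*ˡ (suc n) (+ m) Y) ⟩
  + suc m *ᶻ binomω^Sum m n +ᶻ + m *ᶻ binomω^Sum (pred m) n ∎
  where
  F G H X Y : ℕ → ℤ
  F j = + binom j m *ᶻ ω^ j (suc n)
  G j = + (binom (suc j) m * suc j) *ᶻ ω^ j n
  H j = + (binom j m * j) *ᶻ ω^ j n
  X j = + binom j m *ᶻ ω^ j n
  Y j = + binom j (pred m) *ᶻ ω^ j n
  F-suc : ∀ j → F (suc j) ≡ G j -ᶻ H (suc j)
  F-suc j = trans (scaled-∂ω^ (+ binom (suc j) m) j n)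
    (cong (λ z → z *ᶻ ω^ j n -ᶻ z *ᶻ ω^ (suc j) n) (sym (ℤP.pos-* (binom (suc j) m) (suc j))))
  H0≡0 : H 0 ≡ + 0
  H0≡0 = trans (cong (λ z → + z *ᶻ ω^ 0 n) (ℕP.*-zeroʳ (binom 0 m))) (ℤP.*-zeroˡ (ω^ 0 n))
  Hlast≡0 : H (suc n) ≡ + 0
  Hlast≡0 = trans (cong (+ (binom (suc n) m * suc n) *ᶻ_) (ω^-vanish (suc n) n (ℕP.n<1+n n)))
                  (ℤP.*-zeroʳ (+ (binom (suc n) m * suc n)))

binomω^Sum≡ordS : ∀ n m → binomω^Sum m n ≡ + ordS n m
binomω^Sum≡ordS zero    zero    = refl
binomω^Sum≡ordS zero    (suc m) = trans
  (trans (ℤP.+-identityˡ _) (cong (λ z → + z *ᶻ + 1) (binom-vanish 0 (suc m) (s≤s z≤n))))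
  (cong +_ (sym (ordS-vanish 0 (suc m) (s≤s z≤n))))
binomω^Sum≡ordS (suc n) m = begin
  binomω^Sum m (suc n)
    ≡⟨ binomω^Sum-rec m n ⟩
  + suc m *ᶻ binomω^Sum m n +ᶻ + m *ᶻ binomω^Sum (pred m) n
    ≡⟨ cong₂ (λ x y → + suc m *ᶻ x +ᶻ + m *ᶻ y) (binomω^Sum≡ordS n m) (binomω^Sum≡ordS n (pred m)) ⟩
  + suc m *ᶻ + ordS n m +ᶻ + m *ᶻ + ordS n (pred m)
    ≡⟨ cong₂ _+ᶻ_ (sym (ℤP.pos-* (suc m) (ordS n m))) (sym (ℤP.pos-* m (ordS n (pred m)))) ⟩
  + (suc m * ordS n m) +ᶻ + (m * ordS n (pred m))
    ≡⟨ sym (ℤP.pos-+ (suc m * ordS n m) (m * ordS n (pred m))) ⟩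
  + (suc m * ordS n m + m * ordS n (pred m))
    ≡⟨ cong +_ (sym (ordS-rec n m)) ⟩
  + ordS (suc n) m ∎

binom-suc-split : ∀ j m (a : ℤ) →
  + suc j *ᶻ (a *ᶻ + binom j m) ≡ (+ suc m *ᶻ a) *ᶻ + binom j m +ᶻ (+ suc m *ᶻ a) *ᶻ + binom j (suc m)
binom-suc-split j m a = sym (begin
  (+ suc m *ᶻ a) *ᶻ + binom j m +ᶻ (+ suc m *ᶻ a) *ᶻ + binom j (suc m)
    ≡⟨ factor (+ suc m) a (+ binom j m) (+ binom j (suc m)) ⟩
  a *ᶻ (+ suc m *ᶻ (+ binom j m +ᶻ + binom j (suc m)))
    ≡⟨ cong (λ z → a *ᶻ (+ suc m *ᶻ z)) (sym (ℤP.pos-+ (binom j m) (binom j (suc m)))) ⟩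
  a *ᶻ (+ suc m *ᶻ + binom (suc j) (suc m))
    ≡⟨ cong (a *ᶻ_) (sym (ℤP.pos-* (suc m) (binom (suc j) (suc m)))) ⟩
  a *ᶻ + (suc m * binom (suc j) (suc m))
    ≡⟨ cong (λ z → a *ᶻ + z) (binom-absorb j m) ⟩
  a *ᶻ + (suc j * binom j m)
    ≡⟨ cong (a *ᶻ_) (ℤP.pos-* (suc j) (binom j m)) ⟩
  a *ᶻ (+ suc j *ᶻ + binom j m)
    ≡⟨ swap a (+ suc j) (+ binom j m) ⟩
  + suc j *ᶻ (a *ᶻ + binom j m) ∎)
  where
  factor : ∀ (s A b₀ b₁ : ℤ) → (s *ᶻ A) *ᶻ b₀ +ᶻ (s *ᶻ A) *ᶻ b₁ ≡ A *ᶻ (s *ᶻ (b₀ +ᶻ b₁))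
  factor = ℤ-Solver.solve-∀
  swap : ∀ (A J b : ℤ) → A *ᶻ (J *ᶻ b) ≡ J *ᶻ (A *ᶻ b)
  swap = ℤ-Solver.solve-∀

ordS-rec-ℤ : ∀ k m (c : ℤ) → + ordS (suc k) m *ᶻ c ≡ (+ suc m *ᶻ + ordS k m) *ᶻ c +ᶻ (+ m *ᶻ + ordS k (pred m)) *ᶻ c
ordS-rec-ℤ k m c = trans (cong (λ z → + z *ᶻ c) (ordS-rec k m))
  (trans (cong (_*ᶻ c) (trans (ℤP.pos-+ (suc m * ordS k m) (m * ordS k (pred m)))
                              (cong₂ _+ᶻ_ (ℤP.pos-* (suc m) (ordS k m)) (ℤP.pos-* m (ordS k (pred m))))))
         (ℤP.*-distribʳ-+ c (+ suc m *ᶻ + ordS k m) (+ m *ᶻ + ordS k (pred m))))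

-- Induction on k: multiply by j+1, split with binom-suc-split, shift the
-- second sum by one (its boundary terms vanish) and recombine with ordS-rec.
powerExpansion : ∀ k j B → k < B → + (suc j ^ k) ≡ sumℤ B (λ m → + ordS k m *ᶻ + binom j m)
powerExpansion zero    j (suc B) _ = sym (trans (sumℤ-shift B _) (cong (+ 1 +ᶻ_) higher≡0))
  where
  higher≡0 : sumℤ B (λ m → + ordS 0 (suc m) *ᶻ + binom j (suc m)) ≡ + 0
  higher≡0 = sumℤ-zero B _ (λ m _ →
    trans (cong (λ z → + z *ᶻ + binom j (suc m)) (ordS-vanish 0 (suc m) (s≤s z≤n))) (ℤP.*-zeroˡ (+ binom j (suc m))))
powerExpansion (suc k) j (suc B) (s≤s k<B) = begin
  + (suc j * suc j ^ k)
    ≡⟨ ℤP.pos-* (suc j) (suc j ^ k) ⟩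
  + suc j *ᶻ + (suc j ^ k)
    ≡⟨ cong (+ suc j *ᶻ_) (powerExpansion k j (suc B) (ℕP.m<n⇒m<1+n k<B)) ⟩
  + suc j *ᶻ sumℤ (suc B) (λ m → + ordS k m *ᶻ + binom j m)
    ≡⟨ sym (sumℤ-*ˡ (suc B) (+ suc j) _) ⟩
  sumℤ (suc B) (λ m → + suc j *ᶻ (+ ordS k m *ᶻ + binom j m))
    ≡⟨ sumℤ-cong (suc B) (λ m _ → binom-suc-split j m (+ ordS k m)) ⟩
  sumℤ (suc B) (λ m → X m +ᶻ Y (suc m))
    ≡⟨ sumℤ-+ (suc B) X (λ m → Y (suc m)) ⟩
  sumℤ (suc B) X +ᶻ sumℤ (suc B) (λ m → Y (suc m))
    ≡⟨ cong (sumℤ (suc B) X +ᶻ_) (sumℤ-rotate (suc B) Y (ℤP.*-zeroˡ (+ binom j 0)) Ylast≡0) ⟩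
  sumℤ (suc B) X +ᶻ sumℤ (suc B) Y
    ≡⟨ sym (sumℤ-+ (suc B) X Y) ⟩
  sumℤ (suc B) (λ m → X m +ᶻ Y m)
    ≡⟨ sumℤ-cong (suc B) (λ m _ → sym (ordS-rec-ℤ k m (+ binom j m))) ⟩
  sumℤ (suc B) (λ m → + ordS (suc k) m *ᶻ + binom j m) ∎
  where
  X Y : ℕ → ℤ
  X m = (+ suc m *ᶻ + ordS k m) *ᶻ + binom j m
  Y m = (+ m *ᶻ + ordS k (pred m)) *ᶻ + binom j m
  Ylast≡0 : Y (suc B) ≡ + 0
  Ylast≡0 = trans (cong (λ z → (+ suc B *ᶻ + z) *ᶻ + binom j (suc B)) (ordS-vanish k B k<B))
                  (trans (cong (_*ᶻ + binom j (suc B)) (ℤP.*-zeroʳ (+ suc B))) (ℤP.*-zeroˡ (+ binom j (suc B))))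

-- Second half of the theorem:
--   Σ_m ordS n m · ordS k m = Σ_m ordS k m Σ_j C(j,m) [xⁿ]ω^j
--                          = Σ_j (Σ_m ordS k m C(j,m)) [xⁿ]ω^j = Σ_j (j+1)^k [xⁿ]ω^j.
stirlingSum≡polyBernoulli : ∀ n k → + stirlingSum n k ≡ polyBernoulliNeg n k
stirlingSum≡polyBernoulli n k = begin
  + stirlingSum n k
    ≡⟨ pos-sumℕ B (λ m → ordS n m * ordS k m) ⟩
  sumℤ B (λ m → + (ordS n m * ordS k m))
    ≡⟨ sumℤ-cong B (λ m _ → trans (cong +_ (ℕP.*-comm (ordS n m) (ordS k m)))
         (trans (ℤP.pos-* (ordS k m) (ordS n m)) (cong (+ ordS k m *ᶻ_) (sym (binomω^Sum≡ordS n m))))) ⟩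
  sumℤ B (λ m → + ordS k m *ᶻ binomω^Sum m n)
    ≡⟨ sumℤ-cong B (λ m _ → sym (sumℤ-*ˡ (suc n) (+ ordS k m) _)) ⟩
  sumℤ B (λ m → sumℤ (suc n) (λ j → + ordS k m *ᶻ (+ binom j m *ᶻ ω^ j n)))
    ≡⟨ sumℤ-swap B (suc n) _ ⟩
  sumℤ (suc n) (λ j → sumℤ B (λ m → + ordS k m *ᶻ (+ binom j m *ᶻ ω^ j n)))
    ≡⟨ sumℤ-cong (suc n) (λ j _ → trans (sumℤ-cong B (λ m _ → sym (ℤP.*-assoc (+ ordS k m) (+ binom j m) (ω^ j n))))
                                          (sumℤ-*ʳ B _ (ω^ j n))) ⟩
  sumℤ (suc n) (λ j → sumℤ B (λ m → + ordS k m *ᶻ + binom j m) *ᶻ ω^ j n)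
    ≡⟨ sumℤ-cong (suc n) (λ j _ → cong (_*ᶻ ω^ j n) (sym (powerExpansion k j B (s≤s (ℕP.m≤n+m k n))))) ⟩
  polyBernoulliNeg n k ∎
  where
  B : ℕ
  B = suc (n + k)

-- The Boolean outcome  isYes d  of a decision d, introduced and eliminated.
-- (isYes matches on d itself, so a `with` on the decision reduces it.)

isYes-true : ∀ {a} {P : Set a} (d : Dec P) → P → isYes d ≡ true
isYes-true (yes _) _  = refl
isYes-true (no ¬p) p = ⊥-elim (¬p p)

isYes-false : ∀ {a} {P : Set a} (d : Dec P) → ¬ P → isYes d ≡ false
isYes-false (yes p) ¬p = ⊥-elim (¬p p)
isYes-false (no _)  _  = refl

isYes-true⁻¹ : ∀ {a} {P : Set a} (d : Dec P) → isYes d ≡ true → P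
isYes-true⁻¹ (yes p) _ = p

isYes-false⁻¹ : ∀ {a} {P : Set a} (d : Dec P) → isYes d ≡ false → ¬ P
isYes-false⁻¹ (no ¬p) _ = ¬p

indicator : Bool → ℕ
indicator true  = 1
indicator false = 0

indicator≤1 : ∀ b → indicator b ≤ 1
indicator≤1 true  = ℕP.≤-refl
indicator≤1 false = z≤n

count : ℕ → (ℕ → Bool) → ℕ
count zero    f = 0
count (suc b) f = count b f + indicator (f b)

count-cong : ∀ b (f g : ℕ → Bool) → (∀ i → i < b → f i ≡ g i) → count b f ≡ count b g
count-cong zero    f g h = refl
count-cong (suc b) f g h = cong₂ _+_ (count-cong b f g (λ i i<b → h i (ℕP.m<n⇒m<1+n i<b)))
                                     (cong indicator (h b (ℕP.n<1+n b)))

indicator-mono : ∀ x y → (x ≡ true → y ≡ true) → indicator x ≤ indicator y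
indicator-mono false y h = z≤n
indicator-mono true  y h with h refl
... | refl = ℕP.≤-refl

count-mono : ∀ b (f g : ℕ → Bool) → (∀ i → i < b → f i ≡ true → g i ≡ true) → count b f ≤ count b g
count-mono zero    f g h = z≤n
count-mono (suc b) f g h = ℕP.+-mono-≤ (count-mono b f g (λ i i<b → h i (ℕP.m<n⇒m<1+n i<b)))
                                       (indicator-mono (f b) (g b) (h b (ℕP.n<1+n b)))

count-strict : ∀ b (f g : ℕ → Bool) → (∀ i → i < b → f i ≡ true → g i ≡ true) →
  ∀ j → j < b → f j ≡ false → g j ≡ true → count b f < count b g
count-strict (suc b) f g h j j<b fj gj with ℕP.m≤n⇒m<n∨m≡n (ℕP.≤-pred j<b)
... | inj₂ refl rewrite fj | gj =
  ℕP.+-mono-≤-< (count-mono b f g (λ i i<b → h i (ℕP.m<n⇒m<1+n i<b))) ℕP.≤-refl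
... | inj₁ j<b' = ℕP.+-mono-<-≤ (count-strict b f g (λ i i<b → h i (ℕP.m<n⇒m<1+n i<b)) j j<b' fj gj)
                                (indicator-mono (f b) (g b) (h b (ℕP.n<1+n b)))

count-all : ∀ b (f : ℕ → Bool) → (∀ i → i < b → f i ≡ true) → count b f ≡ b
count-all zero    f h = refl
count-all (suc b) f h rewrite h b (ℕP.n<1+n b) =
  trans (cong (_+ 1) (count-all b f (λ i i<b → h i (ℕP.m<n⇒m<1+n i<b)))) (ℕP.+-comm b 1)

count-none : ∀ b (f : ℕ → Bool) → (∀ i → i < b → f i ≡ false) → count b f ≡ 0
count-none zero    f h = refl
count-none (suc b) f h rewrite h b (ℕP.n<1+n b) =
  trans (ℕP.+-identityʳ _) (count-none b f (λ i i<b → h i (ℕP.m<n⇒m<1+n i<b)))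

count-<-bound : ∀ b (f : ℕ → Bool) j → j < b → f j ≡ false → count b f < b
count-<-bound b f j j<b fj = subst (count b f <_) (count-all b (λ _ → true) (λ _ _ → refl))
  (count-strict b f (λ _ → true) (λ _ _ _ → refl) j j<b fj refl)

count-split : ∀ b (f g : ℕ → Bool) → count b f ≡ count b (λ i → f i ∧ g i) + count b (λ i → f i ∧ not (g i))
count-split zero    f g = refl
count-split (suc b) f g = begin
  count b f + indicator (f b)
    ≡⟨ cong₂ _+_ (count-split b f g) (indicator-split (f b) (g b)) ⟩
  (count b (λ i → f i ∧ g i) + count b (λ i → f i ∧ not (g i))) + (indicator (f b ∧ g b) + indicator (f b ∧ not (g b)))
    ≡⟨ +-interchange (count b (λ i → f i ∧ g i)) _ _ _ ⟩
  (count b (λ i → f i ∧ g i) + indicator (f b ∧ g b)) + (count b (λ i → f i ∧ not (g i)) + indicator (f b ∧ not (g b))) ∎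
  where
  indicator-split : ∀ x y → indicator x ≡ indicator (x ∧ y) + indicator (x ∧ not y)
  indicator-split true  true  = refl
  indicator-split true  false = refl
  indicator-split false y     = refl

count-single : ∀ b (f : ℕ → Bool) j → j < b → f j ≡ true → (∀ i → i < b → f i ≡ true → i ≡ j) → count b f ≡ 1
count-single (suc b) f j j<b fj h with ℕP.m≤n⇒m<n∨m≡n (ℕP.≤-pred j<b)
... | inj₂ refl rewrite fj = cong (_+ 1) (count-none b f others-false)
  where
  others-false : ∀ i → i < b → f i ≡ false
  others-false i i<b with f i in eq
  ... | false = refl
  ... | true  = ⊥-elim (ℕP.<-irrefl (h i (ℕP.m<n⇒m<1+n i<b) eq) i<b)
... | inj₁ j<b' with f b in eq
... | true  = ⊥-elim (ℕP.<-irrefl (sym (h b (ℕP.n<1+n b) eq)) j<b')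
... | false = trans (ℕP.+-identityʳ _) (count-single b f j j<b' fj (λ i i<b → h i (ℕP.m<n⇒m<1+n i<b)))

search : ∀ N (P : ℕ → Set) → (∀ x → Dec (P x)) → (∃ λ x → x < N × P x) ⊎ (∀ x → x < N → ¬ P x)
search zero    P P? = inj₂ (λ x ())
search (suc N) P P? with search N P P?
... | inj₁ (x , x<N , px) = inj₁ (x , ℕP.m<n⇒m<1+n x<N , px)
... | inj₂ none with P? N
...   | yes pN = inj₁ (N , ℕP.n<1+n N , pN)
...   | no ¬pN = inj₂ λ x x<sN px → below-or-at (ℕP.m≤n⇒m<n∨m≡n (ℕP.≤-pred x<sN)) px
  where
  below-or-at : ∀ {x} → x < N ⊎ x ≡ N → P x → ⊥
  below-or-at (inj₁ x<N) px = none _ x<N px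
  below-or-at (inj₂ refl) px = ¬pN px

InjectiveBelow : ℕ → (ℕ → ℕ) → Set
InjectiveBelow N p = ∀ x y → x < N → y < N → p x ≡ p y → x ≡ y

injective⇒surjective : ∀ N (p : ℕ → ℕ) → (∀ x → x < N → p x < N) → InjectiveBelow N p →
  ∀ u → u < N → ∃ λ x → x < N × p x ≡ u
injective⇒surjective N p p< inj u u<N with search N (λ x → p x ≡ u) (λ x → p x ℕ.≟ u)
... | inj₁ w = w
injective⇒surjective (suc M) p p< inj u u<N | inj₂ missed =
  ⊥-elim (ℕP.<-irrefl refl (FP.injective⇒≤ {f = squeeze} squeeze-injective))
  where
  -- p restricted to Fin (M+1) avoids u, hence factors injectively through Fin M.
  pᶠ : Fin (suc M) → Fin (suc M)
  pᶠ x = fromℕ< (p< (toℕ x) (FP.toℕ<n x))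
  avoids : (x : Fin (suc M)) → fromℕ< u<N ≢ pᶠ x
  avoids x eq = missed (toℕ x) (FP.toℕ<n x)
    (sym (trans (sym (FP.toℕ-fromℕ< u<N)) (trans (cong toℕ eq) (FP.toℕ-fromℕ< (p< (toℕ x) (FP.toℕ<n x))))))
  squeeze : Fin (suc M) → Fin M
  squeeze x = F.punchOut (avoids x)
  squeeze-injective : ∀ {x y} → squeeze x ≡ squeeze y → x ≡ y
  squeeze-injective {x} {y} eq = FP.toℕ-injective (inj (toℕ x) (toℕ y) (FP.toℕ<n x) (FP.toℕ<n y)
    (trans (sym (FP.toℕ-fromℕ< (p< (toℕ x) (FP.toℕ<n x))))
      (trans (cong toℕ (FP.punchOut-injective (avoids x) (avoids y) eq)) (FP.toℕ-fromℕ< (p< (toℕ y) (FP.toℕ<n y))))))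

count-below : ∀ N (p : ℕ → ℕ) → InjectiveBelow N p → (∀ u → u < N → ∃ λ x → x < N × p x ≡ u) →
  ∀ v → v ≤ N → count N (λ y → isYes (p y <? v)) ≡ v
count-below N p inj surj zero    _   = count-none N _ (λ i _ → isYes-false (p i <? 0) (λ ()))
count-below N p inj surj (suc v) v<N = begin
  count N below[1+v]
    ≡⟨ count-split N below[1+v] below[v] ⟩
  count N (λ i → below[1+v] i ∧ below[v] i) + count N (λ i → below[1+v] i ∧ not (below[v] i))
    ≡⟨ cong₂ _+_ (trans (count-cong N _ below[v] (λ i _ → below-both (p i) v))
                        (count-below N p inj surj v (ℕP.<⇒≤ v<N)))
                 (count-single N _ x x<N at-x only-x) ⟩
  v + 1
    ≡⟨ ℕP.+-comm v 1 ⟩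
  suc v ∎
  where
  below[1+v] below[v] : ℕ → Bool
  below[1+v] y = isYes (p y <? suc v)
  below[v]   y = isYes (p y <? v)
  below-both : ∀ a b → isYes (a <? suc b) ∧ isYes (a <? b) ≡ isYes (a <? b)
  below-both a b with a <? b
  ... | no _ = BP.∧-zeroʳ (isYes (a <? suc b))
  ... | yes a<b = cong (_∧ true) (isYes-true (a <? suc b) (ℕP.m<n⇒m<1+n a<b))
  x : ℕ
  x = proj₁ (surj v v<N)
  x<N : x < N
  x<N = proj₁ (proj₂ (surj v v<N))
  px≡v : p x ≡ v
  px≡v = proj₂ (proj₂ (surj v v<N))
  at-x : below[1+v] x ∧ not (below[v] x) ≡ true
  at-x rewrite isYes-true (p x <? suc v) (subst (_< suc v) (sym px≡v) (ℕP.n<1+n v))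
             | isYes-false (p x <? v) (λ lt → ℕP.<-irrefl px≡v lt) = refl
  only-x : ∀ i → i < N → below[1+v] i ∧ not (below[v] i) ≡ true → i ≡ x
  only-x i i<N h with p i <? suc v | p i <? v
  ... | yes a | no b = inj i x i<N x<N (trans (ℕP.≤-antisym (ℕP.≤-pred a) (ℕP.≮⇒≥ b)) (sym px≡v))

-- Total lookup in a vector of naturals (0 outside the range).
at : ∀ {l} → Vec ℕ l → ℕ → ℕ
at []       _       = 0
at (x ∷ xs) zero    = x
at (x ∷ xs) (suc i) = at xs i

at-map : ∀ {l} (f : ℕ → ℕ) (v : Vec ℕ l) i → i < l → at (V.map f v) i ≡ f (at v i)
at-map f (x ∷ v) zero    _         = refl
at-map f (x ∷ v) (suc i) (s≤s i<l) = at-map f v i i<l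

map-id-on : ∀ {l} (f : ℕ → ℕ) (v : Vec ℕ l) → (∀ i → i < l → f (at v i) ≡ at v i) → V.map f v ≡ v
map-id-on f []      h = refl
map-id-on f (x ∷ v) h = cong₂ _∷_ (h 0 (s≤s z≤n)) (map-id-on f v (λ i i<l → h (suc i) (s≤s i<l)))

record PinnedSurj (n m : ℕ) : Set where
  constructor mkPinnedSurj
  field
    vec      : Vec ℕ (suc n)
    .bounded : ∀ i → i ≤ n → at vec i ≤ m
    .onto    : ∀ b → b ≤ m → ∃ λ i → i ≤ n × at vec i ≡ b
    .pinned  : at vec n ≡ 0

PinnedSurj-≡ : ∀ {n m} {o o′ : PinnedSurj n m} → PinnedSurj.vec o ≡ PinnedSurj.vec o′ → o ≡ o′
PinnedSurj-≡ {o = mkPinnedSurj v _ _ _} {mkPinnedSurj .v _ _ _} refl = refl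

punchOutℕ : ℕ → ℕ → ℕ
punchOutℕ x y with y <? x
... | yes _ = y
... | no  _ = pred y

punchInℕ : ℕ → ℕ → ℕ
punchInℕ x y with y <? x
... | yes _ = y
... | no  _ = suc y

punchOut-punchIn : ∀ x y → punchOutℕ x (punchInℕ x y) ≡ y
punchOut-punchIn x y with y <? x
... | yes y<x with y <? x
...   | yes _ = refl
...   | no ¬p = Irrelevant.⊥-elim (¬p y<x)
punchOut-punchIn x y | no y≮x with suc y <? x
...   | yes sy<x = Irrelevant.⊥-elim (y≮x (ℕP.<⇒≤ sy<x))
...   | no _     = refl

punchIn-punchOut : ∀ x y → y ≢ x → punchInℕ x (punchOutℕ x y) ≡ y
punchIn-punchOut x y y≢x with y <? x
... | yes y<x with y <? x
...   | yes _ = refl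
...   | no ¬p = Irrelevant.⊥-elim (¬p y<x)
punchIn-punchOut x zero y≢x | no y≮x = Irrelevant.⊥-elim (y≢x (sym (ℕP.n≤0⇒n≡0 (ℕP.≮⇒≥ y≮x))))
punchIn-punchOut x (suc y) y≢x | no y≮x with y <? x
... | yes y<x = Irrelevant.⊥-elim (y≢x (ℕP.≤-antisym y<x (ℕP.≮⇒≥ y≮x)))
... | no _    = refl

punchIn≢ : ∀ x y → punchInℕ x y ≢ x
punchIn≢ x y with y <? x
... | yes y<x = λ eq → ℕP.<-irrefl eq y<x
... | no y≮x  = λ eq → y≮x (subst (y <_) eq (ℕP.n<1+n y))

punchOut-≤ : ∀ x y m → y ≤ m → y ≢ x → x ≤ m → punchOutℕ x y ≤ pred m
punchOut-≤ x y m y≤m y≢x x≤m with y <? x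
... | yes y<x = ℕP.<⇒≤pred (ℕP.<-≤-trans y<x x≤m)
... | no y≮x  = ℕP.pred-mono-≤ y≤m

punchIn-≤ : ∀ x y m → y ≤ pred m → 0 < m → punchInℕ x y ≤ m
punchIn-≤ x y m y≤ 0<m with y <? x
... | yes _ = ℕP.≤-trans y≤ ℕP.pred[n]≤n
... | no _  = subst (suc y ≤_) (ℕP.suc-pred m {{ℕ.>-nonZero 0<m}}) (s≤s y≤)

punchIn-0 : ∀ x → 0 < x → punchInℕ x 0 ≡ 0
punchIn-0 x 0<x with 0 <? x
... | yes _ = refl
... | no ¬p = Irrelevant.⊥-elim (¬p 0<x)

punchOut-0 : ∀ x → 0 < x → punchOutℕ x 0 ≡ 0
punchOut-0 x 0<x with 0 <? x
... | yes _ = refl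
... | no ¬p = Irrelevant.⊥-elim (¬p 0<x)

-- Removing the first value x of a pinned surjection on {0..n+1}: either x is
-- still hit by the rest (any of m+1 values), or it is not, and then x ≥ 1
-- (m choices) and punching x out of the rest gives a surjection onto m values.
-- This is the bijective form of  ordS (n+1) m = (m+1) ordS n m + m ordS n (m-1).

FirstValueSplit : ℕ → ℕ → Set
FirstValueSplit n m = (Fin (suc m) × PinnedSurj n m) ⊎ (Fin m × PinnedSurj n (pred m))

module _ {n m : ℕ} where

  isHit? : (x : ℕ) (xs : Vec ℕ (suc n)) →
    (∃ λ i → i < suc n × at xs i ≡ x) ⊎ (∀ i → i < suc n → ¬ at xs i ≡ x)
  isHit? x xs = search (suc n) (λ i → at xs i ≡ x) (λ i → at xs i ℕ.≟ x)

  onto-tail : (x : ℕ) (xs : Vec ℕ (suc n)) → (∃ λ i → i < suc n × at xs i ≡ x) →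
    (∀ b → b ≤ m → ∃ λ i → i ≤ suc n × at (x ∷ xs) i ≡ b) → ∀ b → b ≤ m → ∃ λ i → i ≤ n × at xs i ≡ b
  onto-tail x xs (j , j<sn , xs[j]≡x) onto b b≤m with onto b b≤m
  ... | zero  , _         , e = j , ℕP.≤-pred j<sn , trans xs[j]≡x e
  ... | suc i , s≤s i≤n   , e = i , i≤n , e

  -- a value missed by the tail is nonzero, since the tail ends in 0
  missed-positive : (x : ℕ) (xs : Vec ℕ (suc n)) → (∀ i → i < suc n → ¬ at xs i ≡ x) → at xs n ≡ 0 → 0 < x
  missed-positive zero    xs missed pinned = Irrelevant.⊥-elim (missed n (ℕP.n<1+n n) pinned)
  missed-positive (suc x) xs missed pinned = s≤s z≤n

  onto-punchedTail : (x : ℕ) (xs : Vec ℕ (suc n)) → (∀ i → i < suc n → ¬ at xs i ≡ x) → 0 < m →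
    (∀ b → b ≤ m → ∃ λ i → i ≤ suc n × at (x ∷ xs) i ≡ b) →
    ∀ b → b ≤ pred m → ∃ λ i → i ≤ n × at (V.map (punchOutℕ x) xs) i ≡ b
  onto-punchedTail x xs missed 0<m onto b b≤ with onto (punchInℕ x b) (punchIn-≤ x b m b≤ 0<m)
  ... | zero  , _       , e = Irrelevant.⊥-elim (punchIn≢ x b (sym e))
  ... | suc i , s≤s i≤n , e = i , i≤n ,
    trans (at-map (punchOutℕ x) xs i (s≤s i≤n)) (trans (cong (punchOutℕ x) e) (punchOut-punchIn x b))

  splitFirst : PinnedSurj (suc n) m → FirstValueSplit n m
  splitFirst (mkPinnedSurj (x ∷ xs) bounded onto pinned) with isHit? x xs
  ... | inj₁ hit = inj₁ (fromℕ< (s≤s (bounded 0 z≤n)) ,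
          mkPinnedSurj xs (λ i i≤n → bounded (suc i) (s≤s i≤n)) (onto-tail x xs hit onto) pinned)
  ... | inj₂ missed = inj₂ (fromℕ< (pred-x<m (missed-positive x xs missed pinned) (bounded 0 z≤n)) ,
          mkPinnedSurj (V.map (punchOutℕ x) xs)
            (λ i i≤n → subst (_≤ pred m) (sym (at-map (punchOutℕ x) xs i (s≤s i≤n)))
               (punchOut-≤ x (at xs i) m (bounded (suc i) (s≤s i≤n)) (missed i (s≤s i≤n)) (bounded 0 z≤n)))
            (onto-punchedTail x xs missed
               (ℕP.<-≤-trans (missed-positive x xs missed pinned) (bounded 0 z≤n)) onto)
            (trans (at-map (punchOutℕ x) xs n (ℕP.n<1+n n))
               (trans (cong (punchOutℕ x) pinned) (punchOut-0 x (missed-positive x xs missed pinned)))))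
    where
    pred-x<m : ∀ {x} → 0 < x → x ≤ m → pred x < m
    pred-x<m (s≤s z≤n) x≤m = x≤m

  joinFirst : FirstValueSplit n m → PinnedSurj (suc n) m
  joinFirst (inj₁ (f , mkPinnedSurj v bounded onto pinned)) =
    mkPinnedSurj (toℕ f ∷ v) (bounded′ bounded) (λ b b≤m → shift (onto b b≤m)) pinned
    where
    bounded′ : (∀ i → i ≤ n → at v i ≤ m) → ∀ i → i ≤ suc n → at (toℕ f ∷ v) i ≤ m
    bounded′ _       zero    _         = ℕP.≤-pred (FP.toℕ<n f)
    bounded′ bounded (suc i) (s≤s i≤n) = bounded i i≤n
    shift : ∀ {b} → ∃ (λ i → i ≤ n × at v i ≡ b) → ∃ λ i → i ≤ suc n × at (toℕ f ∷ v) i ≡ b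
    shift (i , i≤n , e) = suc i , s≤s i≤n , e
  joinFirst (inj₂ (f , mkPinnedSurj v bounded onto pinned)) =
    mkPinnedSurj (x ∷ V.map (punchInℕ x) v) (bounded′ bounded) (onto′ onto)
      (trans (at-map (punchInℕ x) v n (ℕP.n<1+n n)) (trans (cong (punchInℕ x) pinned) (punchIn-0 x (s≤s z≤n))))
    where
    x = suc (toℕ f)
    0<m : 0 < m
    0<m = ℕP.<-≤-trans (s≤s z≤n) (FP.toℕ<n f)
    bounded′ : (∀ i → i ≤ n → at v i ≤ pred m) → ∀ i → i ≤ suc n → at (x ∷ V.map (punchInℕ x) v) i ≤ m
    bounded′ _       zero    _         = FP.toℕ<n f
    bounded′ bounded (suc i) (s≤s i≤n) = subst (_≤ m) (sym (at-map (punchInℕ x) v i (s≤s i≤n)))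
                                        (punchIn-≤ x (at v i) m (bounded i i≤n) 0<m)
    onto′ : (∀ b → b ≤ pred m → ∃ λ i → i ≤ n × at v i ≡ b) →
            ∀ b → b ≤ m → ∃ λ i → i ≤ suc n × at (x ∷ V.map (punchInℕ x) v) i ≡ b
    onto′ onto b b≤m with b ℕ.≟ x
    ... | yes refl = zero , z≤n , refl
    ... | no b≢x with onto (punchOutℕ x b) (punchOut-≤ x b m b≤m b≢x (FP.toℕ<n f))
    ...   | i , i≤n , e = suc i , s≤s i≤n ,
      trans (at-map (punchInℕ x) v i (s≤s i≤n)) (trans (cong (punchInℕ x) e) (punchIn-punchOut x b b≢x))

  splitFirst-joinFirst : ∀ s → splitFirst (joinFirst s) ≡ s
  splitFirst-joinFirst (inj₁ (f , mkPinnedSurj v bounded onto pinned)) with isHit? (toℕ f) v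
  ... | inj₁ _      = cong inj₁ (cong₂ _,_ (FP.fromℕ<-toℕ f _) (PinnedSurj-≡ refl))
  ... | inj₂ missed = Irrelevant.⊥-elim (hit (onto (toℕ f) (ℕP.≤-pred (FP.toℕ<n f))))
    where
    hit : (∃ λ i → i ≤ n × at v i ≡ toℕ f) → ⊥
    hit (i , i≤n , e) = missed i (s≤s i≤n) e
  splitFirst-joinFirst (inj₂ (f , mkPinnedSurj v bounded onto pinned))
    with isHit? (suc (toℕ f)) (V.map (punchInℕ (suc (toℕ f))) v)
  ... | inj₁ (i , i<sn , e) =
    ⊥-elim (punchIn≢ (suc (toℕ f)) (at v i) (trans (sym (at-map (punchInℕ (suc (toℕ f))) v i i<sn)) e))
  ... | inj₂ _ = cong inj₂ (cong₂ _,_ (FP.fromℕ<-toℕ f _) (PinnedSurj-≡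
          (trans (sym (VP.map-∘ (punchOutℕ x) (punchInℕ x) v))
                 (trans (VP.map-cong (punchOut-punchIn x) v) (VP.map-id v)))))
    where x = suc (toℕ f)

  joinFirst-splitFirst : ∀ o → joinFirst (splitFirst o) ≡ o
  joinFirst-splitFirst (mkPinnedSurj (x ∷ xs) bounded onto pinned) with isHit? x xs
  ... | inj₁ _      = PinnedSurj-≡ (cong (_∷ xs) (FP.toℕ-fromℕ< _))
  ... | inj₂ missed = PinnedSurj-≡ (cong₂ _∷_ x′≡x
          (trans (cong (λ y → V.map (punchInℕ y) (V.map (punchOutℕ x) xs)) x′≡x)
            (trans (sym (VP.map-∘ (punchInℕ x) (punchOutℕ x) xs))
                   (map-id-on (λ y → punchInℕ x (punchOutℕ x y)) xs
                              (λ i i<sn → punchIn-punchOut x (at xs i) (missed i i<sn))))))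
    where
    0<x : 0 < x
    0<x = recompute (0 <? x) (missed-positive x xs missed pinned)
    x′≡x : suc (toℕ (fromℕ< {m = pred x} {n = m} _)) ≡ x
    x′≡x = trans (cong suc (FP.toℕ-fromℕ< _)) (ℕP.suc-pred x {{ℕ.>-nonZero 0<x}})

firstValueSplit : ∀ n m → PinnedSurj (suc n) m ↔ FirstValueSplit n m
firstValueSplit n m = mk↔ₛ′ splitFirst joinFirst splitFirst-joinFirst joinFirst-splitFirst

Fin-cong : ∀ {x y} → x ≡ y → Fin x ↔ Fin y
Fin-cong refl = ↔-id _

pinnedSurj-count : ∀ n m → PinnedSurj n m ↔ Fin (ordS n m)
pinnedSurj-count zero zero = mk↔ₛ′ (λ _ → F.zero) (λ _ → only) (λ { F.zero → refl ; (F.suc ()) }) unique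
  where
  only : PinnedSurj 0 0
  only = mkPinnedSurj (0 ∷ []) (λ { zero _ → z≤n }) (λ b b≤0 → 0 , z≤n , sym (ℕP.n≤0⇒n≡0 b≤0)) refl
  unique : ∀ o → only ≡ o
  unique (mkPinnedSurj (x ∷ []) _ _ pinned) = PinnedSurj-≡ (cong (_∷ []) (sym (recompute (x ℕ.≟ 0) pinned)))
pinnedSurj-count zero (suc m) = mk↔ₛ′ (λ o → Irrelevant.⊥-elim (empty o)) (λ i → absurd i) (λ i → absurd i)
                                      (λ o → Irrelevant.⊥-elim (empty o))
  where
  -- a one-point domain cannot cover two values
  empty : PinnedSurj 0 (suc m) → ⊥
  empty (mkPinnedSurj (x ∷ []) _ onto pinned) = Irrelevant.⊥-elim (misses (onto (suc m) ℕP.≤-refl))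
    where
    misses : (∃ λ i → i ≤ 0 × at (x ∷ []) i ≡ suc m) → ⊥
    misses (zero , _ , e) = ℕP.0≢1+n (trans (sym (recompute (x ℕ.≟ 0) pinned)) e)
  absurd : ∀ {A : Set} → Fin (ordS 0 (suc m)) → A
  absurd i with () ← subst Fin (ordS-vanish 0 (suc m) (s≤s z≤n)) i
pinnedSurj-count (suc n) m =
  Fin-cong (sym (ordS-rec n m)) ↔-∘ (↔-sym FP.+↔⊎ ↔-∘ ((↔-sym FP.*↔× ⊎-↔ ↔-sym FP.*↔×) ↔-∘
    (((↔-id _ ×-↔ pinnedSurj-count n m) ⊎-↔ (↔-id _ ×-↔ pinnedSurj-count n (pred m))) ↔-∘ firstValueSplit n m)))

lex-< : ∀ N A B x y → A < B → x < N → A * N + x < B * N + y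
lex-< N A B x y A<B x<N = ℕP.<-≤-trans (ℕP.+-monoʳ-< (A * N) x<N)
  (subst (_≤ B * N + y) (ℕP.+-comm N (A * N)) (ℕP.≤-trans (ℕP.*-monoˡ-≤ N A<B) (ℕP.m≤m+n (B * N) y)))

lex-≤-< : ∀ N A B x y → A ≤ B → x < y → x < N → A * N + x < B * N + y
lex-≤-< N A B x y A≤B x<y x<N with ℕP.m≤n⇒m<n∨m≡n A≤B
... | inj₁ A<B  = lex-< N A B x y A<B x<N
... | inj₂ refl = ℕP.+-monoʳ-< (A * N) x<y

lex-major-≤ : ∀ N A B x y → y < N → A * N + x ≤ B * N + y → A ≤ B
lex-major-≤ N A B x y y<N le with A ≤? B
... | yes A≤B = A≤B
... | no  A≰B = ⊥-elim (ℕP.<⇒≱ (lex-< N B A y x (ℕP.≰⇒> A≰B) y<N) le)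

double-< : ∀ a b s t → a < b → s ≤ 1 → 2 * a + s < 2 * b + t
double-< a b s t a<b s≤1 = ℕP.<-≤-trans (ℕP.+-monoʳ-< (2 * a) (s≤s s≤1))
  (ℕP.≤-trans (ℕP.≤-reflexive (double-suc a)) (ℕP.≤-trans (ℕP.*-monoʳ-≤ 2 a<b) (ℕP.m≤m+n (2 * b) t)))
  where
  double-suc : ∀ a → 2 * a + 2 ≡ 2 * suc a
  double-suc = ℕ-Solver.solve-∀

double-≤-cancel : ∀ a b s → 2 * a + s ≤ 2 * b + s → s ≤ 1 → a ≤ b
double-≤-cancel a b s le s≤1 with a ≤? b
... | yes a≤b = a≤b
... | no  a≰b = ⊥-elim (ℕP.<⇒≱ (double-< b a s s (ℕP.≰⇒> a≰b) s≤1) le)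

≤∧≮⇒≡ : ∀ {a b} → a ≤ b → ¬ a < b → a ≡ b
≤∧≮⇒≡ le ≮ with ℕP.m≤n⇒m<n∨m≡n le
... | inj₁ l = ⊥-elim (≮ l)
... | inj₂ e = e

false≢true : false ≢ true
false≢true ()

-- Max-ascending permutations, viewed as functions p : ℕ → ℕ on [0, N),
-- N = n+k+2: positions 0..n are left, n+1..T = n+k+1 are right.
-- The maximal runs of values lying on one side (the paper's equivalence
-- classes) alternate between the sides, from value 0 on the left to value T
-- on the right; block b is the b-th left run followed by the next right run.

module Blocks (n k : ℕ) where

  N T : ℕ
  N = suc (suc (n + k))
  T = suc (n + k)

  T<N : T < N
  T<N = ℕP.n<1+n T

  isLeft : ℕ → Bool
  isLeft x = isYes (x ≤? n)

  side : ℕ → ℕ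
  side x = indicator (not (isLeft x))

  record IsMaxAsc (p : ℕ → ℕ) : Set where
    field
      bounded      : ∀ x → x < N → p x < N
      injective    : InjectiveBelow N p
      first        : p 0 ≡ 0
      last         : p T ≡ T
      maxAscending : ∀ x y → y < N → x < y → isLeft x ≡ isLeft y →
        (∀ z → z < N → (p x < p z × p z < p y) ⊎ (p y < p z × p z < p x) → isLeft z ≡ isLeft x) →
        p x < p y

  isLeft-T : isLeft T ≡ false
  isLeft-T = isYes-false (T ≤? n) (λ le → ℕP.<-irrefl refl (ℕP.≤-trans le (ℕP.m≤m+n n k)))

  isLeft⇒≤ : ∀ {x} → isLeft x ≡ true → x ≤ n
  isLeft⇒≤ {x} e = isYes-true⁻¹ (x ≤? n) e

  ¬isLeft⇒> : ∀ {x} → isLeft x ≡ false → n < x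
  ¬isLeft⇒> {x} e = ℕP.≰⇒> (isYes-false⁻¹ (x ≤? n) e)

  side-left : ∀ {x} → x ≤ n → side x ≡ 0
  side-left {x} x≤n = cong (λ b → indicator (not b)) (isYes-true (x ≤? n) x≤n)

  side-right : ∀ {x} → n < x → side x ≡ 1
  side-right {x} n<x = cong (λ b → indicator (not b)) (isYes-false (x ≤? n) (ℕP.<⇒≱ n<x))

  left<N : ∀ {z} → z ≤ n → z < N
  left<N z-left = ℕP.≤-<-trans z-left (s≤s (ℕP.≤-trans (ℕP.m≤m+n n k) (ℕP.n≤1+n (n + k))))

  module BlockIndex (p : ℕ → ℕ) where
    -- an inverse of p found by search; only its specification is ever used
    abstract
      p⁻¹ : ℕ → ℕ
      p⁻¹ u with search N (λ x → p x ≡ u) (λ x → p x ℕ.≟ u)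
      ... | inj₁ (x , _ , _) = x
      ... | inj₂ _           = 0

      p⁻¹-spec′ : ∀ u → (∃ λ x → x < N × p x ≡ u) → p⁻¹ u < N × p (p⁻¹ u) ≡ u
      p⁻¹-spec′ u (y , y<N , py≡u) with search N (λ x → p x ≡ u) (λ x → p x ℕ.≟ u)
      ... | inj₁ (x , x<N , e) = x<N , e
      ... | inj₂ none          = ⊥-elim (none y y<N py≡u)

    leftVal : ℕ → Bool
    leftVal u = isLeft (p⁻¹ u)

    newLeftBlock : ℕ → Bool
    newLeftBlock u = not (leftVal u) ∧ leftVal (suc u)

    block : ℕ → ℕ
    block zero    = 0
    block (suc v) = block v + indicator (newLeftBlock v)

    -- positions ordered by (block, side, position): p is recovered as the rank
    key : ℕ → ℕ
    key x = (2 * block (p x) + side x) * N + x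

  module BlockIndexProps (p : ℕ → ℕ) (H : IsMaxAsc p) where
    open IsMaxAsc H
    open BlockIndex p public

    p-surjective : ∀ u → u < N → ∃ λ x → x < N × p x ≡ u
    p-surjective = injective⇒surjective N p bounded injective

    p⁻¹-spec : ∀ u → u < N → p⁻¹ u < N × p (p⁻¹ u) ≡ u
    p⁻¹-spec u u<N = p⁻¹-spec′ u (p-surjective u u<N)

    p⁻¹-p : ∀ x → x < N → p⁻¹ (p x) ≡ x
    p⁻¹-p x x<N = injective (p⁻¹ (p x)) x (proj₁ spec) x<N (proj₂ spec)
      where spec = p⁻¹-spec (p x) (bounded x x<N)

    p⁻¹-0 : p⁻¹ 0 ≡ 0
    p⁻¹-0 = trans (cong p⁻¹ (sym first)) (p⁻¹-p 0 (s≤s z≤n))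

    leftVal-p : ∀ x → x < N → leftVal (p x) ≡ isLeft x
    leftVal-p x x<N = cong isLeft (p⁻¹-p x x<N)

    leftVal-T : leftVal T ≡ false
    leftVal-T = trans (cong isLeft (trans (cong p⁻¹ (sym last)) (p⁻¹-p T T<N))) isLeft-T

    block-step : ∀ v → block v ≤ block (suc v)
    block-step v = ℕP.m≤m+n (block v) _

    block-suc≤ : ∀ v → block (suc v) ≤ suc (block v)
    block-suc≤ v = subst (block v + indicator (newLeftBlock v) ≤_) (ℕP.+-comm (block v) 1)
                         (ℕP.+-monoʳ-≤ (block v) (indicator≤1 (newLeftBlock v)))

    block-mono : ∀ {v w} → v ≤ w → block v ≤ block w
    block-mono {v} {zero}  z≤n = ℕP.≤-refl
    block-mono {v} {suc w} v≤w with ℕP.m≤n⇒m<n∨m≡n v≤w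
    ... | inj₁ v<sw = ℕP.≤-trans (block-mono (ℕP.≤-pred v<sw)) (block-step w)
    ... | inj₂ refl = ℕP.≤-refl

    block≤ : ∀ v → block v ≤ v
    block≤ zero    = z≤n
    block≤ (suc v) = subst (block v + indicator (newLeftBlock v) ≤_) (ℕP.+-comm v 1)
                           (ℕP.+-mono-≤ (block≤ v) (indicator≤1 (newLeftBlock v)))

    -- The last value T is on the right, so it starts no new block: block T ≤ n + k.
    blockT≤ : block T ≤ n + k
    blockT≤ = subst (λ z → block (n + k) + indicator (not (leftVal (n + k)) ∧ z) ≤ n + k) (sym leftVal-T)
      (subst (λ z → block (n + k) + indicator z ≤ n + k) (sym (BP.∧-zeroʳ (not (leftVal (n + k)))))
        (subst (_≤ n + k) (sym (ℕP.+-identityʳ (block (n + k)))) (block≤ (n + k))))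

    block-< : ∀ a b → a < b → leftVal a ≡ false → leftVal b ≡ true → block a < block b
    block-< a (suc b) a<sb La Lsb = case (leftVal b) refl
      where
      case : (x : Bool) → leftVal b ≡ x → block a < block (suc b)
      case false Lb = ℕP.<-≤-trans (s≤s (block-mono (ℕP.≤-pred a<sb)))
        (ℕP.≤-reflexive (trans (ℕP.+-comm 1 (block b))
          (cong (λ z → block b + indicator z) (sym (cong₂ (λ u v → not u ∧ v) Lb Lsb)))))
      case true Lb = ℕP.<-≤-trans (block-< a b a<b La Lb) (block-step b)
        where
        a<b : a < b
        a<b = ℕP.≤∧≢⇒< (ℕP.≤-pred a<sb) (λ { refl → false≢true (trans (sym La) Lb) })

    same-block-between : ∀ x y z → x < N → y < N → z < N → block (p x) ≡ block (p y) →
      isLeft x ≡ isLeft y → p x < p z → p z < p y → isLeft z ≡ isLeft x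
    same-block-between x y z x<N y<N z<N same exy px<pz pz<py = case (isLeft z) (isLeft x) refl refl
      where
      case : ∀ u v → isLeft z ≡ u → isLeft x ≡ v → isLeft z ≡ isLeft x
      case true  true  ez ex = trans ez (sym ex)
      case false false ez ex = trans ez (sym ex)
      case false true  ez ex = ⊥-elim (ℕP.<-irrefl refl
        (ℕP.<-≤-trans (block-< (p z) (p y) pz<py (trans (leftVal-p z z<N) ez) (trans (leftVal-p y y<N) (trans (sym exy) ex)))
                      (subst (_≤ block (p z)) same (block-mono (ℕP.<⇒≤ px<pz)))))
      case true  false ez ex = ⊥-elim (ℕP.<-irrefl refl
        (ℕP.<-≤-trans (block-< (p x) (p z) px<pz (trans (leftVal-p x x<N) ex) (trans (leftVal-p z z<N) ez))
                      (subst (block (p z) ≤_) (sym same) (block-mono (ℕP.<⇒≤ pz<py)))))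

    same-block-same-side : ∀ x y → x < N → y < N → block (p x) ≡ block (p y) → isLeft x ≡ isLeft y →
      p x < p y → x < y
    same-block-same-side x y x<N y<N same exy px<py with ℕP.<-cmp x y
    ... | tri< x<y _ _ = x<y
    ... | tri≈ _ refl _ = ⊥-elim (ℕP.<-irrefl refl px<py)
    ... | tri> _ _ y<x = ⊥-elim (ℕP.<-asym px<py (maxAscending y x x<N y<x (sym exy) between))
      where
      between : ∀ z → z < N → (p y < p z × p z < p x) ⊎ (p x < p z × p z < p y) → isLeft z ≡ isLeft y
      between z z<N (inj₁ (py<pz , pz<px)) = ⊥-elim (ℕP.<-asym px<py (ℕP.<-trans py<pz pz<px))
      between z z<N (inj₂ (px<pz , pz<py)) =
        trans (same-block-between x y z x<N y<N z<N same exy px<pz pz<py) exy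

    key-mono : ∀ x y → x < N → y < N → p x < p y → key x < key y
    key-mono x y x<N y<N px<py with ℕP.m≤n⇒m<n∨m≡n (block-mono {p x} {p y} (ℕP.<⇒≤ px<py))
    ... | inj₁ bx<by = lex-< N _ _ x y (double-< (block (p x)) (block (p y)) (side x) (side y) bx<by (indicator≤1 _)) x<N
    ... | inj₂ same  = case (isLeft x) (isLeft y) refl refl
      where
      same-side : isLeft x ≡ isLeft y → key x < key y
      same-side exy = subst (λ l → l * N + x < (2 * block (p y) + side y) * N + y)
        (sym (cong₂ (λ u v → 2 * u + v) same (cong (λ b → indicator (not b)) exy)))
        (ℕP.+-monoʳ-< ((2 * block (p y) + side y) * N) (same-block-same-side x y x<N y<N same exy px<py))
      case : ∀ u v → isLeft x ≡ u → isLeft y ≡ v → key x < key y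
      case false true ex ey = ⊥-elim (ℕP.<-irrefl same
        (block-< (p x) (p y) px<py (trans (leftVal-p x x<N) ex) (trans (leftVal-p y y<N) ey)))
      case true false ex ey = lex-< N _ _ x y
        (subst₂ _<_ (cong₂ (λ u v → 2 * u + v) (sym same) (sym (side-left (isLeft⇒≤ ex))))
                    (cong (λ v → 2 * block (p y) + v) (sym (side-right (¬isLeft⇒> ey))))
                    (ℕP.+-monoʳ-< (2 * block (p y)) (s≤s z≤n))) x<N
      case true true ex ey = same-side (trans ex (sym ey))
      case false false ex ey = same-side (trans ex (sym ey))

    rank-by-key : ∀ x → x < N → count N (λ z → isYes (key z <? key x)) ≡ p x
    rank-by-key x x<N = trans (count-cong N _ _ same-test)
                              (count-below N p injective p-surjective (p x) (ℕP.<⇒≤ (bounded x x<N)))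
      where
      same-test : ∀ z → z < N → isYes (key z <? key x) ≡ isYes (p z <? p x)
      same-test z z<N with p z <? p x
      ... | yes pz<px = isYes-true (key z <? key x) (key-mono z x z<N x<N pz<px)
      ... | no  pz≮px = isYes-false (key z <? key x) key≮
        where
        key≮ : ¬ key z < key x
        key≮ kz<kx with ℕP.<-cmp (p z) (p x)
        ... | tri< l _ _ = pz≮px l
        ... | tri≈ _ e _ = ℕP.<-irrefl (cong key (injective z x z<N x<N e)) kz<kx
        ... | tri> _ _ g = ℕP.<-asym kz<kx (key-mono x z x<N z<N g)

    first-attain : ∀ w b → b ≤ block w →
      ∃ λ u → u ≤ w × block u ≡ b × (u ≡ 0 ⊎ ∃ λ u′ → u ≡ suc u′ × block u′ < b)
    first-attain zero    b b≤ = 0 , z≤n , sym (ℕP.n≤0⇒n≡0 b≤) , inj₁ refl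
    first-attain (suc w) b b≤ with b ≤? block w
    ... | yes b≤w = let (u , u≤w , e , r) = first-attain w b b≤w in u , ℕP.m≤n⇒m≤1+n u≤w , e , r
    ... | no  b≰w = suc w , ℕP.≤-refl , ℕP.≤-antisym (ℕP.≤-trans (block-suc≤ w) (ℕP.≰⇒> b≰w)) b≤ ,
                    inj₂ (w , refl , ℕP.≰⇒> b≰w)

    newLeftBlock-of : ∀ u → block u < block (suc u) → newLeftBlock u ≡ true
    newLeftBlock-of u jump with newLeftBlock u
    ... | true  = refl
    ... | false = ⊥-elim (ℕP.<-irrefl (sym (ℕP.+-identityʳ (block u))) jump)

    left-blocks-onto : ∀ b → b ≤ block T → ∃ λ x → x ≤ n × block (p x) ≡ b
    left-blocks-onto b b≤ with first-attain T b b≤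
    ... | u , u≤T , e , start = p⁻¹ u , isLeft⇒≤ (leftVal-start start) , trans (cong block (proj₂ spec)) e
      where
      spec = p⁻¹-spec u (s≤s u≤T)
      leftVal-start : (u ≡ 0 ⊎ ∃ λ u′ → u ≡ suc u′ × block u′ < b) → leftVal u ≡ true
      leftVal-start (inj₁ u≡0) = subst (λ w → leftVal w ≡ true) (sym u≡0) (cong isLeft p⁻¹-0)
      leftVal-start (inj₂ (u′ , u≡1+u′ , jump)) = subst (λ w → leftVal w ≡ true) (sym u≡1+u′)
        (BP.∧-conicalʳ _ _ (newLeftBlock-of u′ (subst (block u′ <_) (sym (trans (cong block (sym u≡1+u′)) e)) jump)))

    right-blocks-onto : ∀ b → b ≤ block T → ∃ λ x → n < x × x < N × block (p x) ≡ b
    right-blocks-onto b b≤ with ℕP.m≤n⇒m<n∨m≡n b≤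
    ... | inj₂ refl = T , s≤s (ℕP.m≤m+n n k) , T<N , cong block last
    ... | inj₁ b<bT with first-attain T (suc b) b<bT
    ...   | u , u≤T , e , inj₁ refl = ⊥-elim (ℕP.0≢1+n e)
    ...   | .(suc u′) , u≤T , e , inj₂ (u′ , refl , jump) =
      p⁻¹ u′ , ¬isLeft⇒> rightVal , proj₁ spec , trans (cong block (proj₂ spec)) block-u′
      where
      spec = p⁻¹-spec u′ (ℕP.<-trans (ℕP.n<1+n u′) (s≤s u≤T))
      block-u′ : block u′ ≡ b
      block-u′ = ℕP.≤-antisym (ℕP.≤-pred jump) (ℕP.≤-pred (subst (_≤ suc (block u′)) e (block-suc≤ u′)))
      rightVal : leftVal u′ ≡ false
      rightVal = BP.not-injective (BP.∧-conicalˡ _ _ (newLeftBlock-of u′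
        (subst (block u′ <_) (sym e) (subst (_< suc b) (sym block-u′) (ℕP.n<1+n b)))))

  -- Conversely, an assignment B of block indices 0..m to positions that is
  -- onto on both sides, with B 0 = 0 and B T = m, determines a max-ascending
  -- permutation: rank the positions by (level, position), level = 2B + side.
  record BlockAssignment (m : ℕ) (B : ℕ → ℕ) : Set where
    field
      B-bounded   : ∀ x → x < N → B x ≤ m
      B-leftOnto  : ∀ b → b ≤ m → ∃ λ x → x ≤ n × B x ≡ b
      B-rightOnto : ∀ b → b ≤ m → ∃ λ x → n < x × x < N × B x ≡ b
      B-0         : B 0 ≡ 0
      B-T         : B T ≡ m

  module Ranking (B : ℕ → ℕ) where
    level : ℕ → ℕ
    level x = 2 * B x + side x

    keyᴮ : ℕ → ℕ
    keyᴮ x = level x * N + x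

    rank : ℕ → ℕ
    rank x = count N (λ z → isYes (keyᴮ z <? keyᴮ x))

  module RankingProps (m : ℕ) (B : ℕ → ℕ) (D : BlockAssignment m B) where
    open BlockAssignment D
    open Ranking B public

    level-left : ∀ {z} → z ≤ n → level z ≡ 2 * B z + 0
    level-left {z} z-left = cong (λ s → 2 * B z + s) (side-left z-left)

    level-right : ∀ {z} → n < z → level z ≡ 2 * B z + 1
    level-right {z} n<z = cong (λ s → 2 * B z + s) (side-right n<z)

    level-even : ∀ b → b ≤ m → ∃ λ z → z ≤ n × level z ≡ 2 * b + 0
    level-even b b≤m with B-leftOnto b b≤m
    ... | z , z-left , Bz≡b = z , z-left , trans (level-left z-left) (cong (λ t → 2 * t + 0) Bz≡b)

    level-odd : ∀ b → b ≤ m → ∃ λ z → n < z × z < N × level z ≡ 2 * b + 1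
    level-odd b b≤m with B-rightOnto b b≤m
    ... | z , n<z , z<N , Bz≡b = z , n<z , z<N , trans (level-right n<z) (cong (λ t → 2 * t + 1) Bz≡b)

    level-<⇒keyᴮ-< : ∀ x y → x < N → level x < level y → keyᴮ x < keyᴮ y
    level-<⇒keyᴮ-< x y x<N l = lex-< N (level x) (level y) x y l x<N

    keyᴮ-injective : ∀ x y → x < N → y < N → keyᴮ x ≡ keyᴮ y → x ≡ y
    keyᴮ-injective x y x<N y<N e =
      ℕP.+-cancelˡ-≡ (level x * N) x y (trans e (cong (λ l → l * N + y) (sym same-level)))
      where
      same-level : level x ≡ level y
      same-level = ℕP.≤-antisym (lex-major-≤ N (level x) (level y) x y y<N (ℕP.≤-reflexive e))
                                (lex-major-≤ N (level y) (level x) y x x<N (ℕP.≤-reflexive (sym e)))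

    rank-mono : ∀ x y → x < N → keyᴮ x < keyᴮ y → rank x < rank y
    rank-mono x y x<N kx<ky = count-strict N _ _
      (λ z _ e → isYes-true (keyᴮ z <? keyᴮ y) (ℕP.<-trans (isYes-true⁻¹ (keyᴮ z <? keyᴮ x) e) kx<ky))
      x x<N (isYes-false (keyᴮ x <? keyᴮ x) (ℕP.<-irrefl refl)) (isYes-true (keyᴮ x <? keyᴮ y) kx<ky)

    rank<N : ∀ x → x < N → rank x < N
    rank<N x x<N = count-<-bound N _ x x<N (isYes-false (keyᴮ x <? keyᴮ x) (ℕP.<-irrefl refl))

    rank-reflects : ∀ x y → x < N → y < N → rank x < rank y → keyᴮ x < keyᴮ y
    rank-reflects x y x<N y<N r with ℕP.<-cmp (keyᴮ x) (keyᴮ y)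
    ... | tri< l _ _ = l
    ... | tri≈ _ e _ = ⊥-elim (ℕP.<-irrefl (cong rank (keyᴮ-injective x y x<N y<N e)) r)
    ... | tri> _ _ g = ⊥-elim (ℕP.<-asym r (rank-mono y x y<N g))

    rank-injective : InjectiveBelow N rank
    rank-injective x y x<N y<N e with ℕP.<-cmp (keyᴮ x) (keyᴮ y)
    ... | tri< l _ _  = ⊥-elim (ℕP.<-irrefl e (rank-mono x y x<N l))
    ... | tri≈ _ e′ _ = keyᴮ-injective x y x<N y<N e′
    ... | tri> _ _ g  = ⊥-elim (ℕP.<-irrefl (sym e) (rank-mono y x y<N g))

    rank-0 : rank 0 ≡ 0
    rank-0 = count-none N _ (λ z _ → isYes-false (keyᴮ z <? keyᴮ 0) (λ l → ℕP.n≮0 (subst (keyᴮ z <_) keyᴮ-0 l)))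
      where
      keyᴮ-0 : keyᴮ 0 ≡ 0
      keyᴮ-0 = trans (ℕP.+-identityʳ (level 0 * N)) (cong (λ b → (2 * b + 0) * N) B-0)

    rank-T : rank T ≡ T
    rank-T = trans (cong (_+ indicator (isYes (keyᴮ T <? keyᴮ T))) (count-all T _ (λ z z<T →
               isYes-true (keyᴮ z <? keyᴮ T) (lex-≤-< N (level z) (level T) z T
                 (level≤level-T z (ℕP.<-trans z<T T<N)) z<T (ℕP.<-trans z<T T<N)))))
             (trans (cong (λ b → T + indicator b) (isYes-false (keyᴮ T <? keyᴮ T) (ℕP.<-irrefl refl)))
                    (ℕP.+-identityʳ T))
      where
      level≤level-T : ∀ z → z < N → level z ≤ level T
      level≤level-T z z<N = subst (level z ≤_) (sym (cong₂ (λ b s → 2 * b + s) B-T (side-right (s≤s (ℕP.m≤m+n n k)))))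
        (ℕP.+-mono-≤ (ℕP.*-monoʳ-≤ 2 (B-bounded z z<N)) (indicator≤1 _))

    -- If x < y lie on the same side and all ranks between theirs belong to that
    -- side, then B x ≤ B y: otherwise a level of the other side lies between.
    rank-maxAscending : ∀ x y → y < N → x < y → isLeft x ≡ isLeft y →
      (∀ z → z < N → (rank x < rank z × rank z < rank y) ⊎ (rank y < rank z × rank z < rank x) → isLeft z ≡ isLeft x) →
      rank x < rank y
    rank-maxAscending x y y<N x<y exy between with B x ≤? B y
    ... | yes Bx≤By = rank-mono x y x<N (lex-≤-< N (level x) (level y) x y
          (ℕP.+-mono-≤ (ℕP.*-monoʳ-≤ 2 Bx≤By) (ℕP.≤-reflexive (cong (λ b → indicator (not b)) exy))) x<y x<N)
      where x<N = ℕP.<-trans x<y y<N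
    ... | no Bx≰By = case (isLeft x) refl
      where
      x<N = ℕP.<-trans x<y y<N
      By<Bx = ℕP.≰⇒> Bx≰By
      squeezed : ∀ z → z < N → keyᴮ y < keyᴮ z → keyᴮ z < keyᴮ x → isLeft z ≡ isLeft x
      squeezed z z<N ky<kz kz<kx = between z z<N (inj₂ (rank-mono y z y<N ky<kz , rank-mono z x z<N kz<kx))
      case : ∀ u → isLeft x ≡ u → rank x < rank y
      case true ex with level-odd (B y) (B-bounded y y<N)
      ... | z , n<z , z<N , lz = ⊥-elim (false≢true
              (trans (sym (isYes-false (z ≤? n) (ℕP.<⇒≱ n<z))) (trans (squeezed z z<N ky<kz kz<kx) ex)))
        where
        ky<kz : keyᴮ y < keyᴮ z
        ky<kz = level-<⇒keyᴮ-< y z y<N (subst₂ _<_ (sym (level-left (isLeft⇒≤ (trans (sym exy) ex)))) (sym lz)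
                  (ℕP.+-monoʳ-< (2 * B y) (s≤s z≤n)))
        kz<kx : keyᴮ z < keyᴮ x
        kz<kx = level-<⇒keyᴮ-< z x z<N (subst₂ _<_ (sym lz) (sym (level-left (isLeft⇒≤ ex)))
                  (double-< (B y) (B x) 1 0 By<Bx ℕP.≤-refl))
      case false ex with level-even (B x) (B-bounded x x<N)
      ... | z , z-left , lz = ⊥-elim (false≢true
              (trans (sym ex) (trans (sym (squeezed z (left<N z-left) ky<kz kz<kx)) (isYes-true (z ≤? n) z-left))))
        where
        ky<kz : keyᴮ y < keyᴮ z
        ky<kz = level-<⇒keyᴮ-< y z y<N (subst₂ _<_ (sym (level-right (¬isLeft⇒> (trans (sym exy) ex)))) (sym lz)
                  (double-< (B y) (B x) 1 0 By<Bx ℕP.≤-refl))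
        kz<kx : keyᴮ z < keyᴮ x
        kz<kx = level-<⇒keyᴮ-< z x (left<N z-left) (subst₂ _<_ (sym lz) (sym (level-right (¬isLeft⇒> ex)))
                  (ℕP.+-monoʳ-< (2 * B x) (s≤s z≤n)))

    rank-isMaxAsc : IsMaxAsc rank
    rank-isMaxAsc = record
      { bounded = rank<N ; injective = rank-injective ; first = rank-0 ; last = rank-T ; maxAscending = rank-maxAscending }

  module RankBlocks (m : ℕ) (B : ℕ → ℕ) (D : BlockAssignment m B) where
    open BlockAssignment D
    open RankingProps m B D
    open BlockIndexProps rank rank-isMaxAsc

    -- The positions x, y of two consecutive values v, v+1 have levels
    -- with no occurring level strictly between them; comparing levels
    -- 2B+side gives  B y = B x + [x on the right and y on the left].
    module Consecutive (v : ℕ) (sv<N : suc v < N) where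
      x y : ℕ
      x = p⁻¹ v
      y = p⁻¹ (suc v)

      spec-x : x < N × rank x ≡ v
      spec-x = p⁻¹-spec v (ℕP.<-trans (ℕP.n<1+n v) sv<N)

      spec-y : y < N × rank y ≡ suc v
      spec-y = p⁻¹-spec (suc v) sv<N

      x<N : x < N
      x<N = proj₁ spec-x

      y<N : y < N
      y<N = proj₁ spec-y

      level-x≤level-y : level x ≤ level y
      level-x≤level-y = lex-major-≤ N _ _ x y y<N (ℕP.<⇒≤ (rank-reflects x y x<N y<N
        (subst₂ _<_ (sym (proj₂ spec-x)) (sym (proj₂ spec-y)) (ℕP.n<1+n v))))

      no-level-between : ∀ z → z < N → level x < level z → level z < level y → ⊥
      no-level-between z z<N lx<lz lz<ly = ℕP.<-irrefl refl (ℕP.<-≤-trans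
        (subst (_< rank z) (proj₂ spec-x) (rank-mono x z x<N (level-<⇒keyᴮ-< x z x<N lx<lz)))
        (ℕP.≤-pred (subst (rank z <_) (proj₂ spec-y) (rank-mono z y z<N (level-<⇒keyᴮ-< z y z<N lz<ly)))))

      skipped-even : ∀ b → b ≤ m → level x < 2 * b + 0 → 2 * b + 0 < level y → ⊥
      skipped-even b b≤m lx< <ly with level-even b b≤m
      ... | z , z-left , lz = no-level-between z (left<N z-left) (subst (level x <_) (sym lz) lx<) (subst (_< level y) (sym lz) <ly)

      skipped-odd : ∀ b → b ≤ m → level x < 2 * b + 1 → 2 * b + 1 < level y → ⊥
      skipped-odd b b≤m lx< <ly with level-odd b b≤m
      ... | z , _ , z<N , lz = no-level-between z z<N (subst (level x <_) (sym lz) lx<) (subst (_< level y) (sym lz) <ly)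

      level-x≤level-y′ : ∀ {s t} → level x ≡ 2 * B x + s → level y ≡ 2 * B y + t → 2 * B x + s ≤ 2 * B y + t
      level-x≤level-y′ lx ly = subst₂ _≤_ lx ly level-x≤level-y

      left-left : x ≤ n → y ≤ n → B y ≡ B x
      left-left x-left y-left = sym (≤∧≮⇒≡ Bx≤By Bx≮By)
        where
        Bx≤By : B x ≤ B y
        Bx≤By = double-≤-cancel (B x) (B y) 0 (level-x≤level-y′ (level-left x-left) (level-left y-left)) z≤n
        Bx≮By : ¬ B x < B y
        Bx≮By Bx<By = skipped-odd (B x) (B-bounded x x<N)
          (subst (_< 2 * B x + 1) (sym (level-left x-left)) (ℕP.+-monoʳ-< (2 * B x) (s≤s z≤n)))
          (subst (2 * B x + 1 <_) (sym (level-left y-left)) (double-< (B x) (B y) 1 0 Bx<By ℕP.≤-refl))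

      left-right : x ≤ n → n < y → B y ≡ B x
      left-right x-left n<y = sym (≤∧≮⇒≡ Bx≤By Bx≮By)
        where
        Bx≤By : B x ≤ B y
        Bx≤By with B x ≤? B y
        ... | yes Bx≤By = Bx≤By
        ... | no  Bx≰By = ⊥-elim (ℕP.<⇒≱ (double-< (B y) (B x) 1 0 (ℕP.≰⇒> Bx≰By) ℕP.≤-refl)
                                         (level-x≤level-y′ (level-left x-left) (level-right n<y)))
        Bx≮By : ¬ B x < B y
        Bx≮By Bx<By = skipped-odd (B x) (B-bounded x x<N)
          (subst (_< 2 * B x + 1) (sym (level-left x-left)) (ℕP.+-monoʳ-< (2 * B x) (s≤s z≤n)))
          (subst (2 * B x + 1 <_) (sym (level-right n<y)) (double-< (B x) (B y) 1 1 Bx<By ℕP.≤-refl))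

      right-right : n < x → n < y → B y ≡ B x
      right-right n<x n<y = sym (≤∧≮⇒≡ Bx≤By Bx≮By)
        where
        Bx≤By : B x ≤ B y
        Bx≤By = double-≤-cancel (B x) (B y) 1 (level-x≤level-y′ (level-right n<x) (level-right n<y)) ℕP.≤-refl
        Bx≮By : ¬ B x < B y
        Bx≮By Bx<By = skipped-even (B y) (B-bounded y y<N)
          (subst (_< 2 * B y + 0) (sym (level-right n<x)) (double-< (B x) (B y) 1 0 Bx<By ℕP.≤-refl))
          (subst (2 * B y + 0 <_) (sym (level-right n<y)) (ℕP.+-monoʳ-< (2 * B y) (s≤s z≤n)))

      right-left : n < x → y ≤ n → B y ≡ suc (B x)
      right-left n<x y-left = sym (≤∧≮⇒≡ 1+Bx≤By 1+Bx≮By)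
        where
        1+Bx≤By : suc (B x) ≤ B y
        1+Bx≤By with suc (B x) ≤? B y
        ... | yes le = le
        ... | no  1+Bx≰By = ⊥-elim (ℕP.<⇒≱ (ℕP.≤-<-trans
              (subst₂ _≤_ (sym (level-left y-left)) (ℕP.+-identityʳ (2 * B x))
                (ℕP.+-monoˡ-≤ 0 (ℕP.*-monoʳ-≤ 2 (ℕP.≤-pred (ℕP.≰⇒> 1+Bx≰By)))))
              (subst (2 * B x <_) (sym (level-right n<x))
                (subst (_< 2 * B x + 1) (ℕP.+-identityʳ (2 * B x)) (ℕP.+-monoʳ-< (2 * B x) (s≤s z≤n)))))
              level-x≤level-y)
        1+Bx≮By : ¬ suc (B x) < B y
        1+Bx≮By l = skipped-even (suc (B x)) (ℕP.≤-trans (ℕP.<⇒≤ l) (B-bounded y y<N))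
          (subst (_< 2 * suc (B x) + 0) (sym (level-right n<x)) (double-< (B x) (suc (B x)) 1 0 (ℕP.n<1+n (B x)) ℕP.≤-refl))
          (subst (2 * suc (B x) + 0 <_) (sym (level-left y-left)) (double-< (suc (B x)) (B y) 0 0 l z≤n))

      B-step : B y ≡ B x + indicator (newLeftBlock v)
      B-step = case (isLeft x) (isLeft y) refl refl
        where
        case : ∀ u w → isLeft x ≡ u → isLeft y ≡ w → B y ≡ B x + indicator (not u ∧ w)
        case true  true  ex ey = trans (left-left (isLeft⇒≤ ex) (isLeft⇒≤ ey)) (sym (ℕP.+-identityʳ (B x)))
        case true  false ex ey = trans (left-right (isLeft⇒≤ ex) (¬isLeft⇒> ey)) (sym (ℕP.+-identityʳ (B x)))
        case false false ex ey = trans (right-right (¬isLeft⇒> ex) (¬isLeft⇒> ey)) (sym (ℕP.+-identityʳ (B x)))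
        case false true  ex ey = trans (right-left (¬isLeft⇒> ex) (isLeft⇒≤ ey)) (ℕP.+-comm 1 (B x))

    block-rank⁻¹ : ∀ v → v < N → block v ≡ B (p⁻¹ v)
    block-rank⁻¹ zero    _    = sym (trans (cong B p⁻¹-0) B-0)
    block-rank⁻¹ (suc v) sv<N = trans (cong (_+ indicator (newLeftBlock v)) (block-rank⁻¹ v (ℕP.<-trans (ℕP.n<1+n v) sv<N)))
                                      (sym (Consecutive.B-step v sv<N))

    block-rank : ∀ x → x < N → block (rank x) ≡ B x
    block-rank x x<N = trans (block-rank⁻¹ (rank x) (rank<N x x<N)) (cong B (p⁻¹-p x x<N))

record BoundedΣ (b : ℕ) (X : ℕ → Set) : Set where
  constructor mkBoundedΣ
  field
    index   : ℕ
    .index< : index < b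
    value   : X index

boundedΣ-step : ∀ b X → BoundedΣ (suc b) X ↔ (BoundedΣ b X ⊎ X b)
boundedΣ-step b X = mk↔ₛ′ split join split-join join-split
  where
  split : BoundedΣ (suc b) X → BoundedΣ b X ⊎ X b
  split (mkBoundedΣ m m<1+b x) with m ℕ.≟ b
  ... | yes refl = inj₂ x
  ... | no m≢b   = inj₁ (mkBoundedΣ m (ℕP.≤∧≢⇒< (ℕP.≤-pred m<1+b) m≢b) x)
  join : BoundedΣ b X ⊎ X b → BoundedΣ (suc b) X
  join (inj₁ (mkBoundedΣ m m<b x)) = mkBoundedΣ m (ℕP.m<n⇒m<1+n m<b) x
  join (inj₂ x)             = mkBoundedΣ b (ℕP.n<1+n b) x
  split-join : ∀ s → split (join s) ≡ s
  split-join (inj₁ (mkBoundedΣ m m<b x)) with m ℕ.≟ b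
  ... | yes refl = Irrelevant.⊥-elim (ℕP.<-irrefl refl m<b)
  ... | no _     = refl
  split-join (inj₂ x) with b ℕ.≟ b
  ... | yes refl = refl
  ... | no b≢b   = ⊥-elim (b≢b refl)
  join-split : ∀ s → join (split s) ≡ s
  join-split (mkBoundedΣ m _ x) with m ℕ.≟ b
  ... | yes refl = refl
  ... | no _     = refl

boundedΣ-count : ∀ b X (f : ℕ → ℕ) → (∀ m → X m ↔ Fin (f m)) → BoundedΣ b X ↔ Fin (sumℕ b f)
boundedΣ-count zero    X f count-X = mk↔ₛ′ (λ { (mkBoundedΣ _ m<0 _) → Irrelevant.⊥-elim (ℕP.n≮0 m<0) }) (λ ()) (λ ())
                                            (λ { (mkBoundedΣ _ m<0 _) → Irrelevant.⊥-elim (ℕP.n≮0 m<0) })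
boundedΣ-count (suc b) X f count-X =
  ↔-sym FP.+↔⊎ ↔-∘ ((boundedΣ-count b X f count-X ⊎-↔ count-X b) ↔-∘ boundedΣ-step b X)

vecOf : (ℕ → ℕ) → (l : ℕ) → Vec ℕ l
vecOf f zero    = []
vecOf f (suc l) = f 0 ∷ vecOf (λ i → f (suc i)) l

at-vecOf : ∀ f l i → i < l → at (vecOf f l) i ≡ f i
at-vecOf f (suc l) zero    _         = refl
at-vecOf f (suc l) (suc i) (s≤s i<l) = at-vecOf (λ j → f (suc j)) l i i<l

vecOf-cong : ∀ f g l → (∀ i → i < l → f i ≡ g i) → vecOf f l ≡ vecOf g l
vecOf-cong f g zero    h = refl
vecOf-cong f g (suc l) h = cong₂ _∷_ (h 0 (s≤s z≤n)) (vecOf-cong _ _ l (λ i i<l → h (suc i) (s≤s i<l)))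

vecOf-at : ∀ {l} (v : Vec ℕ l) → vecOf (at v) l ≡ v
vecOf-at []      = refl
vecOf-at (x ∷ v) = cong (x ∷_) (vecOf-at v)

-- Encoding: a permutation with blocks
-- 0..m is sent to the block indices of the left positions (read from n down
-- to 0, so the last entry is block 0) and m minus those of the right
-- positions (read from n+1 up to T, so the last entry is 0).  Decoding ranks
-- the positions by the block assignment these vectors describe.

module Correspondence (n k : ℕ) where
  open Blocks n k

  SurjPair : ℕ → Set
  SurjPair m = PinnedSurj n m × PinnedSurj k m

  Encodings : Set
  Encodings = BoundedΣ (suc (n + k)) SurjPair

  ι : ℕ → Fin N
  ι x with x <? N
  ... | yes x<N = fromℕ< x<N
  ... | no _    = F.zero

  toℕ-ι : ∀ {x} → x < N → toℕ (ι x) ≡ x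
  toℕ-ι {x} x<N with x <? N
  ... | yes l  = FP.toℕ-fromℕ< l
  ... | no x≮N = ⊥-elim (x≮N x<N)

  ι-toℕ : (i : Fin N) → ι (toℕ i) ≡ i
  ι-toℕ i = FP.toℕ-injective (toℕ-ι (FP.toℕ<n i))

  ι-T : ι T ≡ F.fromℕ T
  ι-T = trans (cong ι (sym (FP.toℕ-fromℕ T))) (ι-toℕ (F.fromℕ T))

  asFunction : Vec (Fin N) N → ℕ → ℕ
  asFunction seq x = toℕ (V.lookup seq (ι x))

  n∸<N : ∀ i → n ∸ i < N
  n∸<N i = left<N (ℕP.m∸n≤m n i)

  1+n+<N : ∀ j → j ≤ k → suc n + j < N
  1+n+<N j j≤k = s≤s (s≤s (ℕP.+-monoʳ-≤ n j≤k))

  sideOf : Bool → Side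
  sideOf true  = left
  sideOf false = right

  isLeftSide : Side → Bool
  isLeftSide left  = true
  isLeftSide right = false

  onSide : ∀ b (q : Fin N) → isLeft (toℕ q) ≡ b → OnSide n (sideOf b) q
  onSide true  q e = isLeft⇒≤ e
  onSide false q e = ¬isLeft⇒> e

  isLeft-onSide : ∀ s (q : Fin N) → OnSide n s q → isLeft (toℕ q) ≡ isLeftSide s
  isLeft-onSide left  q o = isYes-true (toℕ q ≤? n) o
  isLeft-onSide right q o = isYes-false (toℕ q ≤? n) (ℕP.<⇒≱ o)

  isMaxAsc-of : (seq : Vec (Fin N) N) → ((i j : Fin N) → V.lookup seq i ≡ V.lookup seq j → i ≡ j) →
    V.lookup seq F.zero ≡ F.zero → V.lookup seq (F.fromℕ T) ≡ F.fromℕ T → MaxAscending n seq →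
    IsMaxAsc (asFunction seq)
  isMaxAsc-of seq isPerm firstVal lastVal maxAsc = record
    { bounded      = λ x _ → FP.toℕ<n _
    ; injective    = injective
    ; first        = cong toℕ firstVal
    ; last         = trans (cong (λ i → toℕ (V.lookup seq i)) ι-T) (trans (cong toℕ lastVal) (FP.toℕ-fromℕ T))
    ; maxAscending = maxAscending }
    where
    p = asFunction seq
    injective : InjectiveBelow N p
    injective x y x<N y<N e =
      trans (sym (toℕ-ι x<N)) (trans (cong toℕ (isPerm (ι x) (ι y) (FP.toℕ-injective e))) (toℕ-ι y<N))
    maxAscending : ∀ x y → y < N → x < y → isLeft x ≡ isLeft y →
      (∀ z → z < N → (p x < p z × p z < p y) ⊎ (p y < p z × p z < p x) → isLeft z ≡ isLeft x) → p x < p y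
    maxAscending x y y<N x<y exy between = maxAsc (sideOf (isLeft x)) (ι x) (ι y)
      (subst₂ _<_ (sym (toℕ-ι x<N)) (sym (toℕ-ι y<N)) x<y)
      (onSide (isLeft x) (ι x) (cong isLeft (toℕ-ι x<N)) ,
       onSide (isLeft x) (ι y) (trans (cong isLeft (toℕ-ι y<N)) (sym exy)) , between′)
      where
      x<N = ℕP.<-trans x<y y<N
      between′ : (v : Fin N) → StrictlyBetween (V.lookup seq (ι x)) v (V.lookup seq (ι y)) →
        (q : Fin N) → V.lookup seq q ≡ v → OnSide n (sideOf (isLeft x)) q
      between′ v v-between q seq[q]≡v = onSide (isLeft x) q (between (toℕ q) (FP.toℕ<n q) (toℕ-between v-between))
        where
        pq≡v : p (toℕ q) ≡ toℕ v
        pq≡v = trans (cong (λ i → toℕ (V.lookup seq i)) (ι-toℕ q)) (cong toℕ seq[q]≡v)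
        toℕ-between : StrictlyBetween (V.lookup seq (ι x)) v (V.lookup seq (ι y)) →
          (p x < p (toℕ q) × p (toℕ q) < p y) ⊎ (p y < p (toℕ q) × p (toℕ q) < p x)
        toℕ-between (inj₁ (l₁ , l₂)) = inj₁ (subst (p x <_) (sym pq≡v) l₁ , subst (_< p y) (sym pq≡v) l₂)
        toℕ-between (inj₂ (l₁ , l₂)) = inj₂ (subst (p y <_) (sym pq≡v) l₁ , subst (_< p x) (sym pq≡v) l₂)

  module Encode (p : ℕ → ℕ) where
    open BlockIndex p

    lastBlock : ℕ
    lastBlock = block T

    leftCode rightCode : ℕ → ℕ
    leftCode  i = block (p (n ∸ i))
    rightCode j = lastBlock ∸ block (p (suc n + j))

    leftVec : Vec ℕ (suc n)
    leftVec = vecOf leftCode (suc n)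

    rightVec : Vec ℕ (suc k)
    rightVec = vecOf rightCode (suc k)

  module EncodeProps (p : ℕ → ℕ) (H : IsMaxAsc p) where
    open IsMaxAsc H
    open BlockIndexProps p H
    open Encode p

    lastBlock< : lastBlock < suc (n + k)
    lastBlock< = s≤s blockT≤

    block≤lastBlock : ∀ x → x < N → block (p x) ≤ lastBlock
    block≤lastBlock x x<N = block-mono (ℕP.≤-pred (bounded x x<N))

    leftVec-bounded : ∀ i → i ≤ n → at leftVec i ≤ lastBlock
    leftVec-bounded i i≤n = subst (_≤ lastBlock) (sym (at-vecOf leftCode (suc n) i (s≤s i≤n)))
                                  (block≤lastBlock (n ∸ i) (n∸<N i))

    leftVec-pinned : at leftVec n ≡ 0
    leftVec-pinned = trans (at-vecOf leftCode (suc n) n (ℕP.n<1+n n))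
                           (trans (cong (λ z → block (p z)) (ℕP.n∸n≡0 n)) (cong block first))

    leftVec-onto : ∀ b → b ≤ lastBlock → ∃ λ i → i ≤ n × at leftVec i ≡ b
    leftVec-onto b b≤ with left-blocks-onto b b≤
    ... | x , x≤n , e = n ∸ x , ℕP.m∸n≤m n x ,
      trans (at-vecOf leftCode (suc n) (n ∸ x) (s≤s (ℕP.m∸n≤m n x))) (trans (cong (λ z → block (p z)) (ℕP.m∸[m∸n]≡n x≤n)) e)

    rightVec-bounded : ∀ j → j ≤ k → at rightVec j ≤ lastBlock
    rightVec-bounded j j≤k = subst (_≤ lastBlock) (sym (at-vecOf rightCode (suc k) j (s≤s j≤k)))
                                   (ℕP.m∸n≤m lastBlock (block (p (suc n + j))))

    rightVec-pinned : at rightVec k ≡ 0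
    rightVec-pinned = trans (at-vecOf rightCode (suc k) k (ℕP.n<1+n k))
                            (trans (cong (λ z → lastBlock ∸ block z) last) (ℕP.n∸n≡0 lastBlock))

    rightVec-onto : ∀ b → b ≤ lastBlock → ∃ λ j → j ≤ k × at rightVec j ≡ b
    rightVec-onto b b≤ with right-blocks-onto (lastBlock ∸ b) (ℕP.m∸n≤m lastBlock b)
    ... | x , n<x , x<N , e = x ∸ suc n , j≤k ,
      trans (at-vecOf rightCode (suc k) (x ∸ suc n) (s≤s j≤k))
        (trans (cong (λ z → lastBlock ∸ block (p z)) (ℕP.m+[n∸m]≡n n<x))
               (trans (cong (lastBlock ∸_) e) (ℕP.m∸[m∸n]≡n b≤)))
      where
      j≤k : x ∸ suc n ≤ k
      j≤k = subst (x ∸ suc n ≤_) (ℕP.m+n∸m≡n (suc n) k) (ℕP.∸-monoˡ-≤ (suc n) (ℕP.≤-pred x<N))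

  -- Proofs are irrelevant in MaxAscPerm and PinnedSurj, so the encoding
  -- takes its hypotheses irrelevantly.
  encode′ : (seq : Vec (Fin N) N) → .(IsMaxAsc (asFunction seq)) → Encodings
  encode′ seq H = mkBoundedΣ lastBlock (EncodeProps.lastBlock< p H)
    ( mkPinnedSurj leftVec (EncodeProps.leftVec-bounded p H) (EncodeProps.leftVec-onto p H) (EncodeProps.leftVec-pinned p H)
    , mkPinnedSurj rightVec (EncodeProps.rightVec-bounded p H) (EncodeProps.rightVec-onto p H) (EncodeProps.rightVec-pinned p H))
    where
    p = asFunction seq
    open Encode p

  encode : MaxAscPerm n k → Encodings
  encode record { seq = seq ; isPerm = isPerm ; firstVal = firstVal ; lastVal = lastVal ; maxAsc = maxAsc } =
    encode′ seq (isMaxAsc-of seq isPerm firstVal lastVal maxAsc)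

  blockFromCodes : ℕ → Vec ℕ (suc n) → Vec ℕ (suc k) → ℕ → Bool → ℕ
  blockFromCodes m v₁ v₂ x true  = at v₁ (n ∸ x)
  blockFromCodes m v₁ v₂ x false = m ∸ at v₂ (x ∸ suc n)

  blockOf : ℕ → Vec ℕ (suc n) → Vec ℕ (suc k) → ℕ → ℕ
  blockOf m v₁ v₂ x = blockFromCodes m v₁ v₂ x (isLeft x)

  blockOf-left : ∀ m v₁ v₂ x → x ≤ n → blockOf m v₁ v₂ x ≡ at v₁ (n ∸ x)
  blockOf-left m v₁ v₂ x x≤n = cong (blockFromCodes m v₁ v₂ x) (isYes-true (x ≤? n) x≤n)

  blockOf-right : ∀ m v₁ v₂ x → n < x → blockOf m v₁ v₂ x ≡ m ∸ at v₂ (x ∸ suc n)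
  blockOf-right m v₁ v₂ x n<x = cong (blockFromCodes m v₁ v₂ x) (isYes-false (x ≤? n) (ℕP.<⇒≱ n<x))

  blockOf-assignment : ∀ m (v₁ : Vec ℕ (suc n)) (v₂ : Vec ℕ (suc k)) →
    (∀ i → i ≤ n → at v₁ i ≤ m) → (∀ b → b ≤ m → ∃ λ i → i ≤ n × at v₁ i ≡ b) → at v₁ n ≡ 0 →
    (∀ i → i ≤ k → at v₂ i ≤ m) → (∀ b → b ≤ m → ∃ λ i → i ≤ k × at v₂ i ≡ b) → at v₂ k ≡ 0 →
    BlockAssignment m (blockOf m v₁ v₂)
  blockOf-assignment m v₁ v₂ bounded₁ onto₁ pinned₁ bounded₂ onto₂ pinned₂ = record
    { B-bounded = B-bounded ; B-leftOnto = B-leftOnto ; B-rightOnto = B-rightOnto ; B-0 = pinned₁ ; B-T = B-T }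
    where
    B = blockOf m v₁ v₂
    B-bounded : ∀ x → x < N → B x ≤ m
    B-bounded x x<N = by-side (x ≤? n)
      where
      by-side : Dec (x ≤ n) → B x ≤ m
      by-side (yes x≤n) = subst (_≤ m) (sym (blockOf-left m v₁ v₂ x x≤n)) (bounded₁ (n ∸ x) (ℕP.m∸n≤m n x))
      by-side (no  x≰n) = subst (_≤ m) (sym (blockOf-right m v₁ v₂ x (ℕP.≰⇒> x≰n))) (ℕP.m∸n≤m m (at v₂ (x ∸ suc n)))
    B-leftOnto : ∀ b → b ≤ m → ∃ λ x → x ≤ n × B x ≡ b
    B-leftOnto b b≤ with onto₁ b b≤
    ... | i , i≤n , e = n ∸ i , ℕP.m∸n≤m n i ,
      trans (blockOf-left m v₁ v₂ (n ∸ i) (ℕP.m∸n≤m n i)) (trans (cong (at v₁) (ℕP.m∸[m∸n]≡n i≤n)) e)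
    B-rightOnto : ∀ b → b ≤ m → ∃ λ x → n < x × x < N × B x ≡ b
    B-rightOnto b b≤ with onto₂ (m ∸ b) (ℕP.m∸n≤m m b)
    ... | j , j≤k , e = suc n + j , s≤s (ℕP.m≤m+n n j) , 1+n+<N j j≤k ,
      trans (blockOf-right m v₁ v₂ (suc n + j) (s≤s (ℕP.m≤m+n n j)))
        (trans (cong (λ z → m ∸ at v₂ z) (ℕP.m+n∸m≡n (suc n) j)) (trans (cong (m ∸_) e) (ℕP.m∸[m∸n]≡n b≤)))
    B-T : B T ≡ m
    B-T = trans (blockOf-right m v₁ v₂ T (s≤s (ℕP.m≤m+n n k)))
                (trans (cong (λ z → m ∸ at v₂ z) (ℕP.m+n∸m≡n (suc n) k)) (cong (m ∸_) pinned₂))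

  module Decode (m : ℕ) (v₁ : Vec ℕ (suc n)) (v₂ : Vec ℕ (suc k)) where
    open Ranking (blockOf m v₁ v₂) public

    decodedSeq : .(BlockAssignment m (blockOf m v₁ v₂)) → Vec (Fin N) N
    decodedSeq D = V.tabulate (λ i → fromℕ< (RankingProps.rank<N m (blockOf m v₁ v₂) D (toℕ i) (FP.toℕ<n i)))

    decodedSeq-lookup : ∀ .(D : BlockAssignment m (blockOf m v₁ v₂)) i → toℕ (V.lookup (decodedSeq D) i) ≡ rank (toℕ i)
    decodedSeq-lookup D i =
      trans (cong toℕ (VP.lookup∘tabulate (λ i → fromℕ< (RankingProps.rank<N m (blockOf m v₁ v₂) D (toℕ i) (FP.toℕ<n i))) i))
            (FP.toℕ-fromℕ< (RankingProps.rank<N m (blockOf m v₁ v₂) D (toℕ i) (FP.toℕ<n i)))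

  module DecodeProps (m : ℕ) (v₁ : Vec ℕ (suc n)) (v₂ : Vec ℕ (suc k)) (D : BlockAssignment m (blockOf m v₁ v₂)) where
    open RankingProps m (blockOf m v₁ v₂) D
    open Decode m v₁ v₂ using (decodedSeq; decodedSeq-lookup)

    seq : Vec (Fin N) N
    seq = decodedSeq D

    decoded-isPerm : (i j : Fin N) → V.lookup seq i ≡ V.lookup seq j → i ≡ j
    decoded-isPerm i j e = FP.toℕ-injective (rank-injective (toℕ i) (toℕ j) (FP.toℕ<n i) (FP.toℕ<n j)
      (trans (sym (decodedSeq-lookup D i)) (trans (cong toℕ e) (decodedSeq-lookup D j))))

    decoded-first : V.lookup seq F.zero ≡ F.zero
    decoded-first = FP.toℕ-injective (trans (decodedSeq-lookup D F.zero) rank-0)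

    decoded-last : V.lookup seq (F.fromℕ T) ≡ F.fromℕ T
    decoded-last = FP.toℕ-injective (trans (decodedSeq-lookup D (F.fromℕ T))
      (trans (cong rank (FP.toℕ-fromℕ T)) (trans rank-T (sym (FP.toℕ-fromℕ T)))))

    decoded-maxAsc : MaxAscending n seq
    decoded-maxAsc s i j i<j (on-s-i , on-s-j , between) =
      subst₂ _<_ (sym (decodedSeq-lookup D i)) (sym (decodedSeq-lookup D j))
        (rank-maxAscending (toℕ i) (toℕ j) (FP.toℕ<n j) i<j
          (trans (isLeft-onSide s i on-s-i) (sym (isLeft-onSide s j on-s-j))) between′)
      where
      between′ : ∀ z → z < N → (rank (toℕ i) < rank z × rank z < rank (toℕ j)) ⊎ (rank (toℕ j) < rank z × rank z < rank (toℕ i)) →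
        isLeft z ≡ isLeft (toℕ i)
      between′ z z<N rank-between = trans (sym (cong isLeft (toℕ-ι z<N)))
        (trans (isLeft-onSide s (ι z) (between (V.lookup seq (ι z)) (lookup-between rank-between) (ι z) refl))
               (sym (isLeft-onSide s i on-s-i)))
        where
        seq[z] : toℕ (V.lookup seq (ι z)) ≡ rank z
        seq[z] = trans (decodedSeq-lookup D (ι z)) (cong rank (toℕ-ι z<N))
        lookup-between : (rank (toℕ i) < rank z × rank z < rank (toℕ j)) ⊎ (rank (toℕ j) < rank z × rank z < rank (toℕ i)) →
          StrictlyBetween (V.lookup seq i) (V.lookup seq (ι z)) (V.lookup seq j)
        lookup-between (inj₁ (l₁ , l₂)) =
          inj₁ (subst₂ _<_ (sym (decodedSeq-lookup D i)) (sym seq[z]) l₁ , subst₂ _<_ (sym seq[z]) (sym (decodedSeq-lookup D j)) l₂)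
        lookup-between (inj₂ (l₁ , l₂)) =
          inj₂ (subst₂ _<_ (sym (decodedSeq-lookup D j)) (sym seq[z]) l₁ , subst₂ _<_ (sym seq[z]) (sym (decodedSeq-lookup D i)) l₂)

  decode′ : ∀ m (v₁ : Vec ℕ (suc n)) (v₂ : Vec ℕ (suc k)) → .(BlockAssignment m (blockOf m v₁ v₂)) → MaxAscPerm n k
  decode′ m v₁ v₂ D = record
    { seq      = Decode.decodedSeq m v₁ v₂ D
    ; isPerm   = DecodeProps.decoded-isPerm m v₁ v₂ D
    ; firstVal = DecodeProps.decoded-first m v₁ v₂ D
    ; lastVal  = DecodeProps.decoded-last m v₁ v₂ D
    ; maxAsc   = DecodeProps.decoded-maxAsc m v₁ v₂ D }

  decode : Encodings → MaxAscPerm n k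
  decode (mkBoundedΣ m _ (mkPinnedSurj v₁ b₁ o₁ p₁ , mkPinnedSurj v₂ b₂ o₂ p₂)) =
    decode′ m v₁ v₂ (blockOf-assignment m v₁ v₂ b₁ o₁ p₁ b₂ o₂ p₂)

  -- decode ∘ encode = id: the block assignment read off the codes is the
  -- block index of p, so the ranking by keys reproduces p.
  module EncodeDecode (seq : Vec (Fin N) N) (H : IsMaxAsc (asFunction seq)) where
    p = asFunction seq
    open BlockIndexProps p H
    open Encode p
    open EncodeProps p H using (block≤lastBlock)

    blockOf-codes : ∀ z → z < N → blockOf lastBlock leftVec rightVec z ≡ block (p z)
    blockOf-codes z z<N = by-side (z ≤? n)
      where
      by-side : Dec (z ≤ n) → blockOf lastBlock leftVec rightVec z ≡ block (p z)
      by-side (yes z-left) = trans (blockOf-left lastBlock leftVec rightVec z z-left)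
        (trans (at-vecOf leftCode (suc n) (n ∸ z) (s≤s (ℕP.m∸n≤m n z))) (cong (λ w → block (p w)) (ℕP.m∸[m∸n]≡n z-left)))
      by-side (no z≰n) = trans (blockOf-right lastBlock leftVec rightVec z (ℕP.≰⇒> z≰n))
        (trans (cong (lastBlock ∸_) (at-vecOf rightCode (suc k) (z ∸ suc n) (s≤s j≤k)))
          (trans (cong (λ w → lastBlock ∸ (lastBlock ∸ block (p w))) (ℕP.m+[n∸m]≡n (ℕP.≰⇒> z≰n)))
                 (ℕP.m∸[m∸n]≡n (block≤lastBlock z z<N))))
        where
        j≤k : z ∸ suc n ≤ k
        j≤k = subst (z ∸ suc n ≤_) (ℕP.m+n∸m≡n (suc n) k) (ℕP.∸-monoˡ-≤ (suc n) (ℕP.≤-pred z<N))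

    rank≡p : ∀ x → x < N → Ranking.rank (blockOf lastBlock leftVec rightVec) x ≡ p x
    rank≡p x x<N = trans (count-cong N _ _ (λ z z<N → cong₂ (λ u v → isYes (u <? v)) (same-key z z<N) (same-key x x<N)))
                         (rank-by-key x x<N)
      where
      same-key : ∀ z → z < N → Ranking.keyᴮ (blockOf lastBlock leftVec rightVec) z ≡ key z
      same-key z z<N = cong (λ b → (2 * b + side z) * N + z) (blockOf-codes z z<N)

    decode-encode-seq : ∀ .(D : BlockAssignment lastBlock (blockOf lastBlock leftVec rightVec)) →
      Decode.decodedSeq lastBlock leftVec rightVec D ≡ seq
    decode-encode-seq D = trans (VP.tabulate-cong same-entry) (VP.tabulate∘lookup seq)
      where
      same-entry : ∀ i → fromℕ< _ ≡ V.lookup seq i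
      same-entry i = FP.toℕ-injective
        (trans (FP.toℕ-fromℕ< (RankingProps.rank<N lastBlock (blockOf lastBlock leftVec rightVec) D (toℕ i) (FP.toℕ<n i)))
          (trans (rank≡p (toℕ i) (FP.toℕ<n i)) (cong (λ j → toℕ (V.lookup seq j)) (ι-toℕ i))))

  MaxAscPerm-≡ : ∀ {π π′ : MaxAscPerm n k} → MaxAscPerm.seq π ≡ MaxAscPerm.seq π′ → π ≡ π′
  MaxAscPerm-≡ {record { seq = seq }} {record { seq = .seq }} refl = refl

  -- decode ∘ encode′ on sequences; the proofs involved are irrelevant in
  -- decode-encode, but sequence equality is decidable and can be recomputed.
  decode∘encode′ : (seq : Vec (Fin N) N) (H : IsMaxAsc (asFunction seq)) → MaxAscPerm.seq (decode (encode′ seq H)) ≡ seq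
  decode∘encode′ seq H = EncodeDecode.decode-encode-seq seq H
    (blockOf-assignment lastBlock leftVec rightVec
      (EncodeProps.leftVec-bounded p H) (EncodeProps.leftVec-onto p H) (EncodeProps.leftVec-pinned p H)
      (EncodeProps.rightVec-bounded p H) (EncodeProps.rightVec-onto p H) (EncodeProps.rightVec-pinned p H))
    where
    p = asFunction seq
    open Encode p

  decode-encode : ∀ π → decode (encode π) ≡ π
  decode-encode record { seq = seq ; isPerm = isPerm ; firstVal = firstVal ; lastVal = lastVal ; maxAsc = maxAsc } =
    MaxAscPerm-≡ (recompute (VP.≡-dec FP._≟_ _ _) (decode∘encode′ seq (isMaxAsc-of seq isPerm firstVal lastVal maxAsc)))

  module SameFunction (p q : ℕ → ℕ) (Hp : IsMaxAsc p) (Hq : IsMaxAsc q) (agree : ∀ x → x < N → p x ≡ q x) where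
    p⁻¹-agree : ∀ u → u < N → BlockIndex.p⁻¹ p u ≡ BlockIndex.p⁻¹ q u
    p⁻¹-agree u u<N = IsMaxAsc.injective Hq (BlockIndex.p⁻¹ p u) (BlockIndex.p⁻¹ q u) (proj₁ spec-p) (proj₁ spec-q)
        (trans (sym (agree (BlockIndex.p⁻¹ p u) (proj₁ spec-p))) (trans (proj₂ spec-p) (sym (proj₂ spec-q))))
      where
      spec-p = BlockIndexProps.p⁻¹-spec p Hp u u<N
      spec-q = BlockIndexProps.p⁻¹-spec q Hq u u<N

    block-agree : ∀ v → v < N → BlockIndex.block p v ≡ BlockIndex.block q v
    block-agree zero    _    = refl
    block-agree (suc v) sv<N = cong₂ _+_ (block-agree v v<N)
      (cong indicator (cong₂ (λ a b → not a ∧ b) (cong isLeft (p⁻¹-agree v v<N)) (cong isLeft (p⁻¹-agree (suc v) sv<N))))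
      where v<N = ℕP.<-trans (ℕP.n<1+n v) sv<N

  -- encode ∘ decode = id: the decoded permutation has block index B, from
  -- which the codes are read back.
  module DecodeEncode (m : ℕ) (v₁ : Vec ℕ (suc n)) (v₂ : Vec ℕ (suc k))
    (bounded₁ : ∀ i → i ≤ n → at v₁ i ≤ m) (onto₁ : ∀ b → b ≤ m → ∃ λ i → i ≤ n × at v₁ i ≡ b) (pinned₁ : at v₁ n ≡ 0)
    (bounded₂ : ∀ i → i ≤ k → at v₂ i ≤ m) (onto₂ : ∀ b → b ≤ m → ∃ λ i → i ≤ k × at v₂ i ≡ b) (pinned₂ : at v₂ k ≡ 0) where
    B = blockOf m v₁ v₂
    D : BlockAssignment m B
    D = blockOf-assignment m v₁ v₂ bounded₁ onto₁ pinned₁ bounded₂ onto₂ pinned₂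
    open RankingProps m B D
    open RankBlocks m B D using (block-rank)

    p : ℕ → ℕ
    p = asFunction (Decode.decodedSeq m v₁ v₂ D)

    H : IsMaxAsc p
    H = isMaxAsc-of (Decode.decodedSeq m v₁ v₂ D) (DecodeProps.decoded-isPerm m v₁ v₂ D) (DecodeProps.decoded-first m v₁ v₂ D)
                      (DecodeProps.decoded-last m v₁ v₂ D) (DecodeProps.decoded-maxAsc m v₁ v₂ D)

    p≡rank : ∀ x → x < N → p x ≡ rank x
    p≡rank x x<N = trans (Decode.decodedSeq-lookup m v₁ v₂ D (ι x)) (cong rank (toℕ-ι x<N))

    open SameFunction p rank H rank-isMaxAsc p≡rank

    block-decoded : ∀ x → x < N → BlockIndex.block p (p x) ≡ B x
    block-decoded x x<N = trans (block-agree (p x) (IsMaxAsc.bounded H x x<N))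
                                (trans (cong (BlockIndex.block rank) (p≡rank x x<N)) (block-rank x x<N))

    lastBlock-decoded : Encode.lastBlock p ≡ m
    lastBlock-decoded = trans (cong (BlockIndex.block p) (sym (IsMaxAsc.last H)))
                              (trans (block-decoded T T<N) (BlockAssignment.B-T D))

    leftVec-decoded : Encode.leftVec p ≡ v₁
    leftVec-decoded = trans (vecOf-cong _ (at v₁) (suc n) (λ i i<1+n → trans (block-decoded (n ∸ i) (n∸<N i))
      (trans (blockOf-left m v₁ v₂ (n ∸ i) (ℕP.m∸n≤m n i)) (cong (at v₁) (ℕP.m∸[m∸n]≡n (ℕP.≤-pred i<1+n))))))
      (vecOf-at v₁)

    rightVec-decoded : Encode.rightVec p ≡ v₂
    rightVec-decoded = trans (vecOf-cong _ (at v₂) (suc k) (λ j j<1+k →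
      trans (cong₂ _∸_ lastBlock-decoded (block-decoded (suc n + j) (1+n+<N j (ℕP.≤-pred j<1+k))))
        (trans (cong (m ∸_) (blockOf-right m v₁ v₂ (suc n + j) (s≤s (ℕP.m≤m+n n j))))
          (trans (cong (λ z → m ∸ (m ∸ at v₂ z)) (ℕP.m+n∸m≡n (suc n) j)) (ℕP.m∸[m∸n]≡n (bounded₂ j (ℕP.≤-pred j<1+k)))))))
      (vecOf-at v₂)

  Encodings-≡ : ∀ {m m′} → m ≡ m′ → ∀ .{l : m < suc (n + k)} .{l′ : m′ < suc (n + k)}
    {a₁ : PinnedSurj n m} {a₂ : PinnedSurj k m} {b₁ : PinnedSurj n m′} {b₂ : PinnedSurj k m′} →
    PinnedSurj.vec a₁ ≡ PinnedSurj.vec b₁ → PinnedSurj.vec a₂ ≡ PinnedSurj.vec b₂ →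
    mkBoundedΣ {b = suc (n + k)} {X = SurjPair} m l (a₁ , a₂) ≡ mkBoundedΣ m′ l′ (b₁ , b₂)
  Encodings-≡ {m} refl {l} e₁ e₂ = cong₂ (λ u v → mkBoundedΣ m l (u , v)) (PinnedSurj-≡ e₁) (PinnedSurj-≡ e₂)

  encode-decode : ∀ s → encode (decode s) ≡ s
  encode-decode (mkBoundedΣ m _ (mkPinnedSurj v₁ b₁ o₁ p₁ , mkPinnedSurj v₂ b₂ o₂ p₂)) = Encodings-≡
    (recompute (Encode.lastBlock p ℕ.≟ m) (DecodeEncode.lastBlock-decoded m v₁ v₂ b₁ o₁ p₁ b₂ o₂ p₂))
    (recompute (VP.≡-dec ℕ._≟_ (Encode.leftVec p) v₁) (DecodeEncode.leftVec-decoded m v₁ v₂ b₁ o₁ p₁ b₂ o₂ p₂))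
    (recompute (VP.≡-dec ℕ._≟_ (Encode.rightVec p) v₂) (DecodeEncode.rightVec-decoded m v₁ v₂ b₁ o₁ p₁ b₂ o₂ p₂))
    where
    p = asFunction (Decode.decodedSeq m v₁ v₂ (blockOf-assignment m v₁ v₂ b₁ o₁ p₁ b₂ o₂ p₂))

  correspondence : MaxAscPerm n k ↔ Encodings
  correspondence = mk↔ₛ′ encode decode encode-decode decode-encode

maxAscPerm-count : ∀ n k → MaxAscPerm n k ↔ Fin (stirlingSum n k)
maxAscPerm-count n k =
  boundedΣ-count (suc (n + k)) (Correspondence.SurjPair n k) (λ m → ordS n m * ordS k m)
    (λ m → ↔-sym FP.*↔× ↔-∘ (pinnedSurj-count n m ×-↔ pinnedSurj-count k m))
  ↔-∘ Correspondence.correspondence n k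

mainTheorem2 : (n k : ℕ) →
    (MaxAscPerm n k ↔ Fin (stirlingSum n k)) × (+ stirlingSum n k ≡ polyBernoulliNeg n k)
mainTheorem2 n k = maxAscPerm-count n k , stirlingSum≡polyBernoulli n k
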